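{- For $n \geq 1$ let $S_n = \{a \in \mathbb{N} : a = x_1^2 + \cdots + x_n^2 \text{ for some integers } x_i \geq 0\}$, and let $R(S_n) = \{a/a' : a,a' \in S_n\}$. (a) $R(S_1)$ is not dense in $\mathbb{Q}_p$ for any prime $p$. (b) For a prime $p$, $R(S_2)$ is dense in $\mathbb{Q}_p$ if and only if $p \equiv 1 \pmod 4$. (c) For every $n \geq 3$, $R(S_n)$ is dense in $\mathbb{Q}_p$ for every prime $p$.
   Context: $\mathbb{N} = \{1,2,\ldots\}$; $\mathbb{Q}_p$ denotes the field of $p$-adic numbers with the $p$-adic metric. -}

module Defs where

open import Data.Nat using (ℕ; _≥_; _^_; _*_)
open import Data.Integer as ℤ using (ℤ; +_)
open import Data.Integer.Divisibility using () renaming (_∣_ to _∣ℤ_)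

open import Data.Product using (Σ; ∃; _×_)
open import Data.Vec using (Vec)

open import Relation.Binary.PropositionalEquality using (_≡_)
open import Relation.Nullary using (¬_)
import Data.Vec as V

sumSq : ∀ {n} → Vec ℕ n → ℕ
sumSq xs = V.sum (V.map (λ x → x * x) xs)

S : ℕ → ℕ → Set
S n a = (a ≥ 1) × ∃ λ (xs : Vec ℕ n) → a ≡ sumSq xs

-- |N/D|_p ≤ p^{-m}  (for D ≠ 0): N/D = p^m * u / w with p ∤ w,
-- i.e. ∃ u w. p ∤ w and N * w = p^m * u * D.
PAdicSmall : (p m : ℕ) (N D : ℤ) → Set
PAdicSmall p m N D =
  ∃ λ (u : ℤ) → ∃ λ (w : ℤ) →
    (¬ ((+ p) ∣ℤ w)) × (N ℤ.* w ≡ (+ (p ^ m)) ℤ.* u ℤ.* D)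

-- R(A) = { a/a' : a, a' ∈ A } is dense in ℚ_p.
-- Since ℚ is dense in ℚ_p, this means: for every rational b/c (c ≥ 1)
-- and every m, some a/a' ∈ R(A) satisfies |a/a' - b/c|_p ≤ p^{-m},
-- i.e. |(a c - a' b)/(a' c)|_p ≤ p^{-m}.
RatiosDenseInQp : (p : ℕ) (A : ℕ → Set) → Set
RatiosDenseInQp p A =
  (b : ℤ) (c : ℕ) → c ≥ 1 → (m : ℕ) →
    ∃ λ (a : ℕ) → ∃ λ (a' : ℕ) → A a × A a' ×
      PAdicSmall p m ((+ a) ℤ.* (+ c) ℤ.- (+ a') ℤ.* b) ((+ a') ℤ.* (+ c))

{-# OPTIONS --safe #-}
-- The ratios a / a' with a' a p-adic unit and a ≡ t·a' (mod p^K) approximate the integer t; since S_n is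
-- closed under multiplication by squares, approximating every integer t = b·c in this way approximates
-- every rational b / c = b·c / c², which is dense in ℚ_p.
--
-- For odd p: if -1 ≡ ‖v‖² / s² (mod p^K), then ((t+1)s)² + (t-1)²‖v‖² ≡ t·(2s)² (mod p^K). Modulo p, -1 is
-- a sum of two squares for every odd p (pigeonhole on x² and -1 - y²), and a square exactly when p ≡ 1 (mod 4):
-- the number of fixed points of the involution pairing x ∈ [1, (p-1)/2] with ±x⁻¹ has the parity of (p-1)/2,
-- and these fixed points are 1 and the square roots of -1.
-- Such representations lift to every p^K through (2sv)² + (s² - ‖v‖²)² = (‖v‖² + s²)².
-- For p = 2, write t = 4^i·r with 4 ∤ r; then r or 3r is y² + z² + 1 (mod 8) for small y, z, and every
-- number ≡ 1 (mod 8) is an odd square modulo every power of 2.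
--
-- Non-density is infinite descent: the elements of S₁ (and of S₂ when -1 is not a square mod p) have even
-- p-adic valuation, so no a / a' is p-adically close to p; the elements of S₂ are powers of 2 times numbers
-- ≡ 1 (mod 4), so no a / a' is 2-adically close to 3.
module Submission where

open import Defs
open import Data.Nat using (ℕ; _≤_; _%_)
open import Data.Nat.Primality using (Prime)
open import Data.Product using (_×_)
open import Relation.Binary.PropositionalEquality using (_≡_)
open import Relation.Nullary using (¬_)

open import Data.Empty using (⊥; ⊥-elim)
open import Data.Fin as Fin using (Fin; toℕ; fromℕ<; splitAt; join)
import Data.Fin.Properties as Fin
open import Data.Integer as ℤ using (ℤ; +_; -[1+_]; -_; _+_; _-_; _*_; ∣_∣; 0ℤ; 1ℤ)
import Data.Integer.DivMod as ℤ
open import Data.Integer.Divisibility.Signed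
import Data.Integer.Properties as ℤ
open import Data.Integer.Tactic.RingSolver using (solve-∀)
open import Data.List using (List; []; _∷_; length; filter; applyUpTo)
open import Data.List.Membership.Propositional using (_∈_)
open import Data.List.Membership.Propositional.Properties
  using (∈-filter⁺; ∈-filter⁻; ∈-applyUpTo⁺; ∈-applyUpTo⁻)
open import Data.List.Properties using (filter-accept; filter-reject; filter-all; length-applyUpTo)
open import Data.List.Relation.Unary.All as All using (All; _∷_)
open import Data.List.Relation.Unary.AllPairs using (_∷_)
open import Data.List.Relation.Unary.Any using (here; there)
open import Data.List.Relation.Unary.Unique.Propositional using (Unique)
import Data.List.Relation.Unary.Unique.Propositional.Properties as Unique
open import Data.Nat as ℕ using (zero; suc; z≤n; s≤s; _<_; _^_; NonZero; parity)
open import Data.Nat.Coprimality using (Coprime; coprime-Bézout)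
import Data.Nat.DivMod as ℕ
open import Data.Nat.Divisibility as ℕ∣ using () renaming (_∣_ to _∣ℕ_; divides to dividesℕ)
open import Data.Nat.GCD using (module Bézout)
open import Data.Nat.Induction using (<-wellFounded)
open import Data.Nat.Primality
  using (prime[2]; euclidsLemma; prime⇒irreducible; prime⇒nonZero; prime⇒nonTrivial)
import Data.Nat.Properties as ℕ
open import Data.Nat.Tactic.RingSolver using () renaming (solve-∀ to ℕ-solve-∀)
open import Data.Parity.Base using (0ℙ; 1ℙ; _⁻¹)
open import Data.Parity.Properties using (suc-homo-⁻¹; ⁻¹-selfInverse)
open import Data.Product using (∃; ∃₂; _,_; proj₁; proj₂)
open import Data.Sum using (_⊎_; inj₁; inj₂; [_,_]′)
open import Data.Vec as V using (Vec; []; _∷_)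
open import Function using (_∘_; id)
open import Induction.WellFounded using (Acc; acc)
open import Relation.Binary.Definitions using (DecidableEquality)
open import Relation.Binary.PropositionalEquality
  using (_≢_; refl; sym; trans; cong; cong₂; subst; subst₂; module ≡-Reasoning)
open import Relation.Nullary using (Dec; yes; no; ¬?; contradiction)
open import Relation.Nullary.Decidable using (_×-dec_; from-no)

private variable
  p d n m a : ℕ
  A : ℕ → Set
  x y : ℤ

prime>1 : Prime p → 1 < p
prime>1 p-prime = ℕ.nonTrivial⇒n>1 _ {{prime⇒nonTrivial p-prime}}

1<p*p : Prime p → 1 < p ℕ.* p
1<p*p {p} p-prime = ℕ.<-≤-trans (prime>1 p-prime) (ℕ.m≤m*n p p {{prime⇒nonZero p-prime}})

x<k*x : ∀ {k x} → 1 < k → 1 ≤ x → x < k ℕ.* x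
x<k*x {k} {x} 1<k x≥1 = subst (x <_) (ℕ.*-comm x k) (ℕ.m<m*n x k {{ℕ.>-nonZero x≥1}} 1<k)

1≤sq : ∀ {x} → 1 ≤ x → 1 ≤ x ℕ.* x
1≤sq x≥1 = ℕ.*-mono-≤ x≥1 x≥1

1≤k*s⇒1≤s : ∀ k {s} → 1 ≤ k ℕ.* s → 1 ≤ s
1≤k*s⇒1≤s k {zero}  k*0≥1 = ⊥-elim (ℕ.<⇒≱ k*0≥1 (ℕ.≤-reflexive (ℕ.*-zeroʳ k)))
1≤k*s⇒1≤s k {suc s} _     = s≤s z≤n

pos-*-* : ∀ x y z → + (x ℕ.* y ℕ.* z) ≡ + x * + y * + z
pos-*-* x y z = trans (ℤ.pos-* (x ℕ.* y) z) (cong (_* + z) (ℤ.pos-* x y))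

euclidsLemmaℤ : Prime p → ∀ x y → + p ∣ x * y → (+ p ∣ x) ⊎ (+ p ∣ y)
euclidsLemmaℤ p-prime x y p∣xy
  with euclidsLemma ∣ x ∣ ∣ y ∣ p-prime (subst (_ ∣ℕ_) (ℤ.abs-* x y) (∣⇒∣ᵤ p∣xy))
... | inj₁ p∣x = inj₁ (∣ᵤ⇒∣ p∣x)
... | inj₂ p∣y = inj₂ (∣ᵤ⇒∣ p∣y)

prime∣sq⇒∣ : Prime p → ∀ x → + p ∣ x * x → + p ∣ x
prime∣sq⇒∣ p-prime x p∣xx = [ id , id ]′ (euclidsLemmaℤ p-prime x x p∣xx)

∣-small⇒≡0 : ∣ x ∣ < d → + d ∣ x → x ≡ 0ℤ
∣-small⇒≡0 {+ zero}    _   _   = refl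
∣-small⇒≡0 {+ suc n}   lt d∣x = ⊥-elim (ℕ∣.>⇒∤ lt (∣⇒∣ᵤ d∣x))
∣-small⇒≡0 { -[1+ n ]} lt d∣x = ⊥-elim (ℕ∣.>⇒∤ lt (∣⇒∣ᵤ d∣x))

∤⇒1≤∣∣ : ∀ x → ¬ (+ d ∣ x) → 1 ≤ ∣ x ∣
∤⇒1≤∣∣ (+ zero)  d∤0 = ⊥-elim (d∤0 (divides 0ℤ refl))
∤⇒1≤∣∣ (+ suc n) _   = s≤s z≤n
∤⇒1≤∣∣ -[1+ n ]  _   = s≤s z≤n

prime∤1 : Prime p → ¬ (+ p ∣ 1ℤ)
prime∤1 p-prime p∣1 with ∣-small⇒≡0 (prime>1 p-prime) p∣1
... | ()

2∤odd : ∀ m → ¬ (+ 2 ∣ m + m + 1ℤ)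
2∤odd m 2∣odd = prime∤1 prime[2] (subst (+ 2 ∣_) (odd-even m) (∣m∣n⇒∣m-n 2∣odd (∣n⇒∣m*n m ∣-refl)))
  where
  odd-even : ∀ m → m + m + 1ℤ - m * + 2 ≡ 1ℤ
  odd-even = solve-∀

inverseMod : Prime p → ¬ p ∣ℕ n → ∃ λ v → + p ∣ + n * v - 1ℤ
inverseMod {p} {n} p-prime p∤n with coprime-Bézout n-coprime-p
  where
  n-coprime-p : Coprime n p
  n-coprime-p (d∣n , d∣p) with prime⇒irreducible p-prime d∣p
  ... | inj₁ d≡1 = d≡1
  ... | inj₂ refl = ⊥-elim (p∤n d∣n)
... | Bézout.+- a b 1+bp≡an = + a , divides (+ b) (begin
  + n * + a - 1ℤ          ≡⟨ cong (_- 1ℤ) (trans (ℤ.*-comm (+ n) (+ a)) (sym (ℤ.pos-* a n))) ⟩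
  + (a ℕ.* n) - 1ℤ        ≡⟨ cong (λ k → + k - 1ℤ) (sym 1+bp≡an) ⟩
  + (1 ℕ.+ b ℕ.* p) - 1ℤ  ≡⟨ cong (_- 1ℤ) (trans (ℤ.pos-+ 1 (b ℕ.* p))
                                                  (cong (λ k → 1ℤ + k) (ℤ.pos-* b p))) ⟩
  1ℤ + + b * + p - 1ℤ     ≡⟨ 1+x-1≡x (+ b * + p) ⟩
  + b * + p               ∎)
  where
  open ≡-Reasoning
  1+x-1≡x : ∀ x → 1ℤ + x - 1ℤ ≡ x
  1+x-1≡x = solve-∀
... | Bézout.-+ a b 1+an≡bp = - + a , divides (- + b) (begin
  + n * - + a - 1ℤ        ≡⟨ rearrange (+ n) (+ a) ⟩
  - (1ℤ + + a * + n)      ≡⟨ cong -_ (trans (cong (λ k → 1ℤ + k) (sym (ℤ.pos-* a n)))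
                                             (sym (ℤ.pos-+ 1 (a ℕ.* n)))) ⟩
  - + (1 ℕ.+ a ℕ.* n)     ≡⟨ cong (λ k → - + k) 1+an≡bp ⟩
  - + (b ℕ.* p)           ≡⟨ cong -_ (ℤ.pos-* b p) ⟩
  - (+ b * + p)           ≡⟨ ℤ.neg-distribˡ-* (+ b) (+ p) ⟩
  - + b * + p             ∎)
  where
  open ≡-Reasoning
  rearrange : ∀ n a → n * - a - 1ℤ ≡ - (1ℤ + a * n)
  rearrange = solve-∀

factorOut : 1 < d → ∀ n → .{{NonZero n}} → ∃₂ λ e m → n ≡ d ^ e ℕ.* m × ¬ d ∣ℕ m
factorOut {d} 1<d n = go n (<-wellFounded n)
  where
  go : ∀ n → .{{NonZero n}} → Acc _<_ n → ∃₂ λ e m → n ≡ d ^ e ℕ.* m × ¬ d ∣ℕ m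
  go n (acc rec) with d ℕ∣.∣? n
  ... | no d∤n = 0 , n , sym (ℕ.+-identityʳ n) , d∤n
  ... | yes (dividesℕ q refl) =
    let instance _ = ℕ.m*n≢0⇒m≢0 q
        e , m , q≡ , d∤m = go q (rec (ℕ.m<m*n q d 1<d))
    in suc e , m ,
       trans (cong (ℕ._* d) q≡) (trans (ℕ.*-comm (d ^ e ℕ.* m) d) (sym (ℕ.*-assoc d (d ^ e) m))) , d∤m

factorOutℤ : 1 < d → ∀ t → t ≢ 0ℤ → ∃₂ λ e ρ → t ≡ + (d ^ e) * ρ × ¬ (+ d ∣ ρ)
factorOutℤ 1<d (+ zero)  t≢0 = ⊥-elim (t≢0 refl)
factorOutℤ {d} 1<d (+ suc n) _ =
  let e , m , n≡ , d∤m = factorOut 1<d (suc n)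
  in e , + m , trans (cong +_ n≡) (ℤ.pos-* (d ^ e) m) , λ d∣m → d∤m (∣⇒∣ᵤ d∣m)
factorOutℤ {d} 1<d -[1+ n ] _ =
  let e , m , n≡ , d∤m = factorOut 1<d (suc n)
  in e , - + m ,
     trans (cong (λ k → - + k) n≡) (trans (cong -_ (ℤ.pos-* (d ^ e) m)) (ℤ.neg-distribʳ-* (+ (d ^ e)) (+ m))) ,
     λ d∣-m → d∤m (∣⇒∣ᵤ (subst (+ d ∣_) (ℤ.neg-involutive (+ m)) (∣m⇒∣-m d∣-m)))

parity-split : ∀ n → ∃ λ k → n ≡ k ℕ.+ k ⊎ n ≡ suc (k ℕ.+ k)
parity-split zero    = 0 , inj₁ refl
parity-split (suc n) with parity-split n
... | k , inj₁ refl = k , inj₂ refl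
... | k , inj₂ refl = suc k , inj₁ (cong suc (sym (ℕ.+-suc k k)))

parityℤ : ∀ x → ∃ λ q → x ≡ q + q ⊎ x ≡ q + q + 1ℤ
parityℤ x = split (x ℤ.%ℕ 2) (ℤ.n%ℕd<d x 2) (ℤ.a≡a%ℕn+[a/ℕn]*n x 2)
  where
  split : ∀ r → r < 2 → x ≡ + r + (x ℤ./ℕ 2) * + 2 → ∃ λ q → x ≡ q + q ⊎ x ≡ q + q + 1ℤ
  split 0 _ x≡ = x ℤ./ℕ 2 , inj₁ (trans x≡ (double (x ℤ./ℕ 2)))
    where
    double : ∀ q → + 0 + q * + 2 ≡ q + q
    double = solve-∀
  split 1 _ x≡ = x ℤ./ℕ 2 , inj₂ (trans x≡ (double+1 (x ℤ./ℕ 2)))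
    where
    double+1 : ∀ q → + 1 + q * + 2 ≡ q + q + 1ℤ
    double+1 = solve-∀
  split (suc (suc _)) (s≤s (s≤s ())) _

parity-suc : ∀ {m n} → parity m ≡ parity n → parity (suc m) ≡ parity (suc n)
parity-suc {m} {n} eq =
  trans (sym (⁻¹-selfInverse (suc-homo-⁻¹ m))) (trans (cong _⁻¹ eq) (⁻¹-selfInverse (suc-homo-⁻¹ n)))

prime≡2⊎odd : Prime p → p ≡ 2 ⊎ ∃ λ h → p ≡ suc (h ℕ.+ h)
prime≡2⊎odd {p} p-prime = by-parity (parity-split p)
  where
  by-parity : (∃ λ k → p ≡ k ℕ.+ k ⊎ p ≡ suc (k ℕ.+ k)) → p ≡ 2 ⊎ ∃ λ h → p ≡ suc (h ℕ.+ h)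
  by-parity (k , inj₂ p≡2k+1) = inj₂ (k , p≡2k+1)
  by-parity (k , inj₁ p≡2k) with prime⇒irreducible p-prime (dividesℕ k (trans p≡2k (double k)))
    where
    double : ∀ k → k ℕ.+ k ≡ k ℕ.* 2
    double = ℕ-solve-∀
  ... | inj₁ ()
  ... | inj₂ 2≡p = inj₁ (sym 2≡p)

private
  %4-+4 : ∀ h → suc (suc (suc h) ℕ.+ suc (suc h)) % 4 ≡ suc (h ℕ.+ h) % 4
  %4-+4 h = trans (cong (_% 4) (plus-four h)) (ℕ.[m+n]%n≡m%n (suc (h ℕ.+ h)) 4)
    where
    plus-four : ∀ h → suc (suc (suc h) ℕ.+ suc (suc h)) ≡ suc (h ℕ.+ h) ℕ.+ 4
    plus-four = ℕ-solve-∀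

odd%4 : ∀ h → (parity h ≡ 0ℙ × suc (h ℕ.+ h) % 4 ≡ 1) ⊎ (parity h ≡ 1ℙ × suc (h ℕ.+ h) % 4 ≡ 3)
odd%4 zero          = inj₁ (refl , refl)
odd%4 (suc zero)    = inj₂ (refl , refl)
odd%4 (suc (suc h)) with odd%4 h
... | inj₁ (even , ≡1) = inj₁ (even , trans (%4-+4 h) ≡1)
... | inj₂ (odd , ≡3)  = inj₂ (odd , trans (%4-+4 h) ≡3)

4^e≡2^e*2^e : ∀ e → 4 ^ e ≡ 2 ^ e ℕ.* 2 ^ e
4^e≡2^e*2^e zero    = refl
4^e≡2^e*2^e (suc e) = trans (cong (4 ℕ.*_) (4^e≡2^e*2^e e)) (regroup (2 ^ e))
  where
  regroup : ∀ x → 4 ℕ.* (x ℕ.* x) ≡ 2 ℕ.* x ℕ.* (2 ℕ.* x)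
  regroup = ℕ-solve-∀

-- Sums of squares

sumSqℤ : ∀ {k} → Vec ℤ k → ℤ
sumSqℤ []      = 0ℤ
sumSqℤ (x ∷ v) = x * x + sumSqℤ v

sumSq-map-* : ∀ {k} c (xs : Vec ℕ k) → sumSq (V.map (c ℕ.*_) xs) ≡ c ℕ.* c ℕ.* sumSq xs
sumSq-map-* c []       = sym (ℕ.*-zeroʳ (c ℕ.* c))
sumSq-map-* c (x ∷ xs) = begin
  c ℕ.* x ℕ.* (c ℕ.* x) ℕ.+ sumSq (V.map (c ℕ.*_) xs)
    ≡⟨ cong (c ℕ.* x ℕ.* (c ℕ.* x) ℕ.+_) (sumSq-map-* c xs) ⟩
  c ℕ.* x ℕ.* (c ℕ.* x) ℕ.+ c ℕ.* c ℕ.* sumSq xs      ≡⟨ factor c x (sumSq xs) ⟩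
  c ℕ.* c ℕ.* (x ℕ.* x ℕ.+ sumSq xs)                  ∎
  where
  open ≡-Reasoning
  factor : ∀ c x s → c ℕ.* x ℕ.* (c ℕ.* x) ℕ.+ c ℕ.* c ℕ.* s ≡ c ℕ.* c ℕ.* (x ℕ.* x ℕ.+ s)
  factor = ℕ-solve-∀

sumSqℤ-map-* : ∀ {k} c (v : Vec ℤ k) → sumSqℤ (V.map (c *_) v) ≡ c * c * sumSqℤ v
sumSqℤ-map-* c []      = sym (ℤ.*-zeroʳ (c * c))
sumSqℤ-map-* c (x ∷ v) = begin
  c * x * (c * x) + sumSqℤ (V.map (c *_) v) ≡⟨ cong (λ s → c * x * (c * x) + s) (sumSqℤ-map-* c v) ⟩
  c * x * (c * x) + c * c * sumSqℤ v        ≡⟨ factor c x (sumSqℤ v) ⟩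
  c * c * (x * x + sumSqℤ v)                ∎
  where
  open ≡-Reasoning
  factor : ∀ c x s → c * x * (c * x) + c * c * s ≡ c * c * (x * x + s)
  factor = solve-∀

+sq-abs : ∀ x → + (∣ x ∣ ℕ.* ∣ x ∣) ≡ x * x
+sq-abs (+ n)    = ℤ.pos-* n n
+sq-abs -[1+ n ] = refl

+sumSq : ∀ {k} (xs : Vec ℕ k) → + sumSq xs ≡ sumSqℤ (V.map +_ xs)
+sumSq []       = refl
+sumSq (x ∷ xs) = trans (ℤ.pos-+ (x ℕ.* x) (sumSq xs)) (cong₂ _+_ (ℤ.pos-* x x) (+sumSq xs))

+sumSq-map-abs : ∀ {k} (v : Vec ℤ k) → + sumSq (V.map ∣_∣ v) ≡ sumSqℤ v
+sumSq-map-abs []      = refl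
+sumSq-map-abs (x ∷ v) =
  trans (ℤ.pos-+ (∣ x ∣ ℕ.* ∣ x ∣) (sumSq (V.map ∣_∣ v))) (cong₂ _+_ (+sq-abs x) (+sumSq-map-abs v))

+sumSq₂ : ∀ {x y X Y} → + x ≡ X → + y ≡ Y → + sumSq (x ∷ y ∷ []) ≡ X * X + (Y * Y + 0ℤ)
+sumSq₂ {x} {y} refl refl = +sumSq (x ∷ y ∷ [])

S-≤ : m ≤ n → S m a → S n a
S-≤ m≤n = go (ℕ.≤⇒≤′ m≤n)
  where
  go : m ℕ.≤′ n → S m a → S n a
  go (ℕ.≤′-reflexive refl) Sa                = Sa
  go (ℕ.≤′-step m≤′n)      Sa with go m≤′n Sa
  ... | a≥1 , xs , a≡ = a≥1 , 0 ∷ xs , a≡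

S-scale : ∀ c → 1 ≤ c → S n a → S n (c ℕ.* c ℕ.* a)
S-scale c c≥1 (a≥1 , xs , refl) = ℕ.*-mono-≤ (1≤sq c≥1) a≥1 , V.map (c ℕ.*_) xs , sym (sumSq-map-* c xs)

S-square : 1 ≤ n → ∀ {x} → 1 ≤ x → S n (x ℕ.* x)
S-square n≥1 {x} x≥1 = S-≤ n≥1 (1≤sq x≥1 , x ∷ [] , sym (ℕ.+-identityʳ (x ℕ.* x)))

halve : 1 ≤ a → ∀ s t → + a ≡ + 2 * sumSqℤ (s ∷ t ∷ []) → ∃ λ b → a ≡ 2 ℕ.* b × S 2 b
halve {a} a≥1 s t a≡ =
  b , a≡2b , (1≤k*s⇒1≤s 2 (subst (1 ≤_) a≡2b a≥1) , ∣ s ∣ ∷ ∣ t ∣ ∷ [] , refl)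
  where
  b = sumSq (V.map ∣_∣ (s ∷ t ∷ []))
  a≡2b : a ≡ 2 ℕ.* b
  a≡2b = ℤ.+-injective (trans a≡ (trans (cong (+ 2 *_) (sym (+sumSq-map-abs (s ∷ t ∷ [])))) (sym (ℤ.pos-* 2 b))))

S₂-cases : S 2 a → (∃ λ k → + a ≡ + 4 * k + 1ℤ) ⊎ (∃ λ b → a ≡ 2 ℕ.* b × S 2 b)
S₂-cases {a} (a≥1 , x ∷ y ∷ [] , refl) with parityℤ (+ x) | parityℤ (+ y)
... | i , inj₁ x≡ | j , inj₂ y≡ = inj₁ (i * i + j * j + j , trans (+sumSq₂ x≡ y≡) (even-odd i j))
  where
  even-odd : ∀ i j → (i + i) * (i + i) + ((j + j + 1ℤ) * (j + j + 1ℤ) + 0ℤ) ≡ + 4 * (i * i + j * j + j) + 1ℤ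
  even-odd = solve-∀
... | i , inj₂ x≡ | j , inj₁ y≡ = inj₁ (i * i + j * j + i , trans (+sumSq₂ x≡ y≡) (odd-even i j))
  where
  odd-even : ∀ i j → (i + i + 1ℤ) * (i + i + 1ℤ) + ((j + j) * (j + j) + 0ℤ) ≡ + 4 * (i * i + j * j + i) + 1ℤ
  odd-even = solve-∀
... | i , inj₁ x≡ | j , inj₁ y≡ = inj₂ (halve a≥1 (i + j) (i - j) (trans (+sumSq₂ x≡ y≡) (even-even i j)))
  where
  even-even : ∀ i j → (i + i) * (i + i) + ((j + j) * (j + j) + 0ℤ) ≡
                      + 2 * ((i + j) * (i + j) + ((i - j) * (i - j) + 0ℤ))
  even-even = solve-∀
... | i , inj₂ x≡ | j , inj₂ y≡ =
  inj₂ (halve a≥1 (i + j + 1ℤ) (i - j) (trans (+sumSq₂ x≡ y≡) (odd-odd i j)))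
  where
  odd-odd : ∀ i j → (i + i + 1ℤ) * (i + i + 1ℤ) + ((j + j + 1ℤ) * (j + j + 1ℤ) + 0ℤ) ≡
                    + 2 * ((i + j + 1ℤ) * (i + j + 1ℤ) + ((i - j) * (i - j) + 0ℤ))
  odd-odd = solve-∀

-- Density of ratios from approximation of integers

ApproximatesIntegers : ℕ → (ℕ → Set) → Set
ApproximatesIntegers p A =
  ∀ (t : ℤ) K → ∃₂ λ a a' → A a × A a' × ¬ p ∣ℕ a' × + (p ^ K) ∣ + a - t * + a'

ratio-error-identity : ∀ a b C A' C' E P k → C ≡ E * C' → a - b * C * A' ≡ k * (P * E * E) →
          (a * C - C * C * A' * b) * (A' * C' * C') ≡ P * k * (C * C * A' * C)
ratio-error-identity a b C A' C' E P k refl a-bCA'≡ = begin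
  (a * (E * C') - (E * C') * (E * C') * A' * b) * (A' * C' * C')
    ≡⟨ pull-out a b (E * C') A' C' ⟩
  (E * C') * (a - b * (E * C') * A') * (A' * C' * C')
    ≡⟨ cong (λ X → (E * C') * X * (A' * C' * C')) a-bCA'≡ ⟩
  (E * C') * (k * (P * E * E)) * (A' * C' * C')
    ≡⟨ regroup E C' k P A' ⟩
  P * k * ((E * C') * (E * C') * A' * (E * C')) ∎
  where
  open ≡-Reasoning
  pull-out : ∀ a b C A' C' → (a * C - C * C * A' * b) * (A' * C' * C') ≡ C * (a - b * C * A') * (A' * C' * C')
  pull-out = solve-∀
  regroup : ∀ E C' k P A' → E * C' * (k * (P * E * E)) * (A' * C' * C') ≡ P * k * (E * C' * (E * C') * A' * (E * C'))
  regroup = solve-∀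

-- a / a' ≈ b c gives a / (c² a') ≈ b / c; precision p^m needs K = m + 2 v_p(c)
approximatesIntegers⇒ratiosDense : Prime p → (∀ {a} c → 1 ≤ c → A a → A (c ℕ.* c ℕ.* a)) →
                                   ApproximatesIntegers p A → RatiosDenseInQp p A
approximatesIntegers⇒ratiosDense {p} {A} p-prime scale approx b c c≥1 m
  with factorOut (prime>1 p-prime) c {{ℕ.>-nonZero c≥1}}
... | e , c' , c≡ , p∤c' with approx (b * + c) (m ℕ.+ e ℕ.+ e)
... | a , a' , Aa , Aa' , p∤a' , divides k a-bca'≡ =
  a , c ℕ.* c ℕ.* a' , Aa , scale c c≥1 Aa' , k , + (a' ℕ.* c' ℕ.* c') , p∤w , equation
  where
  open ≡-Reasoning
  C = + c
  C' = + c'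
  A' = + a'
  P = + (p ^ m)
  E = + (p ^ e)

  p∤w : ¬ p ∣ℕ a' ℕ.* c' ℕ.* c'
  p∤w p∣w with euclidsLemma _ _ p-prime p∣w
  ... | inj₂ p∣c' = p∤c' p∣c'
  ... | inj₁ p∣a'c' = [ p∤a' , p∤c' ]′ (euclidsLemma _ _ p-prime p∣a'c')

  C≡EC' : C ≡ E * C'
  C≡EC' = trans (cong +_ c≡) (ℤ.pos-* (p ^ e) c')

  p^K≡PEE : + (p ^ (m ℕ.+ e ℕ.+ e)) ≡ P * E * E
  p^K≡PEE = trans (cong +_ (trans (ℕ.^-distribˡ-+-* p (m ℕ.+ e) e) (cong (ℕ._* p ^ e) (ℕ.^-distribˡ-+-* p m e))))
                  (trans (ℤ.pos-* (p ^ m ℕ.* p ^ e) (p ^ e)) (cong (_* E) (ℤ.pos-* (p ^ m) (p ^ e))))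

  equation : (+ a * C - + (c ℕ.* c ℕ.* a') * b) * + (a' ℕ.* c' ℕ.* c') ≡ P * k * (+ (c ℕ.* c ℕ.* a') * C)
  equation = begin
    (+ a * C - + (c ℕ.* c ℕ.* a') * b) * + (a' ℕ.* c' ℕ.* c')
      ≡⟨ cong₂ (λ X W → (+ a * C - X * b) * W) (pos-*-* c c a') (pos-*-* a' c' c') ⟩
    (+ a * C - C * C * A' * b) * (A' * C' * C')
      ≡⟨ ratio-error-identity (+ a) b C A' C' E P k C≡EC' (trans a-bca'≡ (cong (k *_) p^K≡PEE)) ⟩
    P * k * (C * C * A' * C)
      ≡⟨ cong (λ X → P * k * (X * C)) (sym (pos-*-* c c a')) ⟩
    P * k * (+ (c ℕ.* c ℕ.* a') * C) ∎

ratiosDense⇒approximates : RatiosDenseInQp p A → ∀ t m →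
  ∃₂ λ a a' → A a × A a' × ∃ λ w → ¬ (+ p ∣ w) × + (p ^ m) * + a' ∣ (+ a - t * + a') * w
ratiosDense⇒approximates {p} dense t m =
  let a , a' , Aa , Aa' , u , w , p∤w , eq = dense t 1 ℕ.≤-refl m
  in a , a' , Aa , Aa' , w , (λ p∣w → p∤w (∣⇒∣ᵤ p∣w)) ,
     divides u (trans (normalise (+ a) (+ a') t w) (trans eq (rearrange (+ (p ^ m)) u (+ a'))))
  where
  normalise : ∀ a a' t w → (a - t * a') * w ≡ (a * + 1 - a' * t) * w
  normalise = solve-∀
  rearrange : ∀ P u a' → P * u * (a' * + 1) ≡ u * (P * a')
  rearrange = solve-∀

-- Obstructions to density

-- descent form of: every element of A has even p-adic valuation
EvenValuations : ℕ → (ℕ → Set) → Set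
EvenValuations p A = ∀ {a} → A a → p ∣ℕ a → ∃ λ a₁ → a ≡ p ℕ.* p ℕ.* a₁ × A a₁

module _ {p : ℕ} {A : ℕ → Set} (p-prime : Prime p) (positive : ∀ {a} → A a → 1 ≤ a)
         (even : EvenValuations p A) {w : ℤ} (P∤w : ¬ (+ p ∣ w)) where

  private
    P = + p
    instance
      p≢0 : NonZero p
      p≢0 = prime⇒nonZero p-prime

    P∣a : ∀ a a' → P * P * + a' ∣ (+ a - P * + a') * w → p ∣ℕ a
    P∣a a a' h = [ ∣⇒∣ᵤ , (λ P∣w → ⊥-elim (P∤w P∣w)) ]′ (euclidsLemmaℤ p-prime (+ a) w P∣aw)
      where
      add-back : ∀ a a' P w → (a - P * a') * w + P * (a' * w) ≡ a * w
      add-back = solve-∀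
      P∣aw : P ∣ + a * w
      P∣aw = subst (P ∣_) (add-back (+ a) (+ a') P w)
        (∣m∣n⇒∣m+n (∣-trans (∣m⇒∣m*n (+ a') (∣m⇒∣m*n P ∣-refl)) h) (∣m⇒∣m*n (+ a' * w) ∣-refl))

    cancel-a : ∀ a₁ a' → P * P * + a' ∣ (+ (p ℕ.* p ℕ.* a₁) - P * + a') * w →
               P * + a' ∣ (P * + a₁ - + a') * w
    cancel-a a₁ a' h = *-cancelˡ-∣ P (subst₂ _∣_ (ℤ.*-assoc P P (+ a'))
      (trans (cong (λ X → (X - P * + a') * w) (pos-*-* p p a₁)) (factor P (+ a₁) (+ a') w)) h)
      where
      factor : ∀ P a₁ a' w → (P * P * a₁ - P * a') * w ≡ P * ((P * a₁ - a') * w)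
      factor = solve-∀

    P∣a' : ∀ a₁ a' → P * + a' ∣ (P * + a₁ - + a') * w → p ∣ℕ a'
    P∣a' a₁ a' h = [ ∣⇒∣ᵤ , (λ P∣w → ⊥-elim (P∤w P∣w)) ]′ (euclidsLemmaℤ p-prime (+ a') w P∣a'w)
      where
      difference : ∀ P a₁ a' w → P * (a₁ * w) - (P * a₁ - a') * w ≡ a' * w
      difference = solve-∀
      P∣a'w : P ∣ + a' * w
      P∣a'w = subst (P ∣_) (difference P (+ a₁) (+ a') w)
        (∣m∣n⇒∣m-n (∣m⇒∣m*n (+ a₁ * w) ∣-refl) (∣-trans (∣m⇒∣m*n (+ a') ∣-refl) h))

    cancel-a' : ∀ a₁ a₁' → P * + (p ℕ.* p ℕ.* a₁') ∣ (P * + a₁ - + (p ℕ.* p ℕ.* a₁')) * w →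
                P * P * + a₁' ∣ (+ a₁ - P * + a₁') * w
    cancel-a' a₁ a₁' h = *-cancelˡ-∣ P (subst₂ _∣_ (cong (P *_) (pos-*-* p p a₁'))
      (trans (cong (λ X → (P * + a₁ - X) * w) (pos-*-* p p a₁')) (factor P (+ a₁) (+ a₁') w)) h)
      where
      factor : ∀ P a₁ a₁' w → (P * a₁ - P * P * a₁') * w ≡ P * ((a₁ - P * a₁') * w)
      factor = solve-∀

  -- P² a' ∣ (a - p a') w with p ∤ w says |a / a' - p|_p ≤ p⁻²
  p-not-approximable : ∀ {a a'} → Acc _<_ a' → A a → A a' → P * P * + a' ∣ (+ a - P * + a') * w → ⊥
  p-not-approximable {a} {a'} (acc rec) Aa Aa' h = strip-a (even Aa (P∣a a a' h))
    where
    strip-a : (∃ λ a₁ → a ≡ p ℕ.* p ℕ.* a₁ × A a₁) → ⊥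
    strip-a (a₁ , refl , Aa₁) = strip-a' (even Aa' (P∣a' a₁ a' h₁))
      where
      h₁ = cancel-a a₁ a' h
      strip-a' : (∃ λ a₁' → a' ≡ p ℕ.* p ℕ.* a₁' × A a₁') → ⊥
      strip-a' (a₁' , refl , Aa₁') =
        p-not-approximable (rec (x<k*x (1<p*p p-prime) (positive Aa₁'))) Aa₁ Aa₁' (cancel-a' a₁ a₁' h₁)

evenValuations⇒¬ratiosDense : Prime p → (∀ {a} → A a → 1 ≤ a) → EvenValuations p A →
                               ¬ RatiosDenseInQp p A
evenValuations⇒¬ratiosDense {p} p-prime positive even dense =
  let a , a' , Aa , Aa' , w , P∤w , close = ratiosDense⇒approximates dense (+ p) 2
  in p-not-approximable p-prime positive even P∤w (<-wellFounded a') Aa Aa'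
       (subst (_∣ (+ a - + p * + a') * w) (p²a'≡ {a'}) close)
  where
  p²a'≡ : ∀ {a'} → + (p ^ 2) * + a' ≡ + p * + p * + a'
  p²a'≡ {a'} = cong (_* + a') (trans (cong (λ q → + (p ℕ.* q)) (ℕ.*-identityʳ p)) (ℤ.pos-* p p))

S-evenValuations : (∀ (xs : Vec ℕ n) → p ∣ℕ sumSq xs → ∃ λ ys → xs ≡ V.map (p ℕ.*_) ys) →
                   EvenValuations p (S n)
S-evenValuations {p = p} divide (a≥1 , xs , refl) p∣a with divide xs p∣a
... | ys , refl = sumSq ys , sumSq-map-* p ys , (1≤k*s⇒1≤s (p ℕ.* p) a≥1' , ys , refl)
  where
  a≥1' : 1 ≤ p ℕ.* p ℕ.* sumSq ys
  a≥1' = subst (1 ≤_) (sumSq-map-* p ys) a≥1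

S₁-evenValuations : Prime p → EvenValuations p (S 1)
S₁-evenValuations {p} p-prime = S-evenValuations divide
  where
  divide : ∀ (xs : Vec ℕ 1) → p ∣ℕ sumSq xs → ∃ λ ys → xs ≡ V.map (p ℕ.*_) ys
  divide (x ∷ []) p∣xx+0 with euclidsLemma x x p-prime (subst (p ∣ℕ_) (ℕ.+-identityʳ (x ℕ.* x)) p∣xx+0)
  ... | inj₁ (dividesℕ q refl) = q ∷ [] , cong (_∷ []) (ℕ.*-comm q p)
  ... | inj₂ (dividesℕ q refl) = q ∷ [] , cong (_∷ []) (ℕ.*-comm q p)

S₂-evenValuations : Prime p → (∀ z → ¬ (+ p ∣ z * z + 1ℤ)) → EvenValuations p (S 2)
S₂-evenValuations {p} p-prime no-root = S-evenValuations divide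
  where
  P = + p

  P∣y : ∀ {x y} → P ∣ + x * + x + (+ y * + y + 0ℤ) → P ∣ + y
  P∣y {x} {y} P∣sum = decide (p ℕ∣.∣? y)
    where
    identity : ∀ x y v → v * v * (x * x + (y * y + 0ℤ)) - (y * v + 1ℤ) * (y * v - 1ℤ) ≡ x * v * (x * v) + 1ℤ
    identity = solve-∀
    decide : Dec (p ∣ℕ y) → P ∣ + y
    decide (yes p∣y) = ∣ᵤ⇒∣ p∣y
    decide (no p∤y)  =
      let v , P∣yv-1 = inverseMod p-prime p∤y
      in ⊥-elim (no-root (+ x * v) (subst (P ∣_) (identity (+ x) (+ y) v)
           (∣m∣n⇒∣m-n (∣n⇒∣m*n (v * v) P∣sum) (∣n⇒∣m*n (+ y * v + 1ℤ) P∣yv-1))))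

  P∣x : ∀ {x y} → P ∣ + x * + x + (+ y * + y + 0ℤ) → P ∣ + y → P ∣ + x
  P∣x {x} {y} P∣sum P∣y = prime∣sq⇒∣ p-prime (+ x) (subst (P ∣_) (difference (+ x * + x) (+ y * + y))
    (∣m∣n⇒∣m-n P∣sum (∣m⇒∣m*n (+ y) P∣y)))
    where
    difference : ∀ s t → s + (t + 0ℤ) - t ≡ s
    difference = solve-∀

  unscale : ∀ {x} (P∣x : P ∣ + x) → x ≡ p ℕ.* ∣ quotient P∣x ∣
  unscale {x} (divides q x≡) = trans (cong ∣_∣ x≡) (trans (ℤ.abs-* q P) (ℕ.*-comm ∣ q ∣ p))

  divide : ∀ (xs : Vec ℕ 2) → p ∣ℕ sumSq xs → ∃ λ ys → xs ≡ V.map (p ℕ.*_) ys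
  divide (x ∷ y ∷ []) p∣sum = ∣ quotient P∣x' ∣ ∷ ∣ quotient P∣y' ∣ ∷ [] ,
                               cong₂ (λ u v → u ∷ v ∷ []) (unscale P∣x') (unscale P∣y')
    where
    P∣sum = subst (P ∣_) (+sumSq (x ∷ y ∷ [])) (∣ᵤ⇒∣ p∣sum)
    P∣y' = P∣y {x} {y} P∣sum
    P∣x' = P∣x {x} {y} P∣sum P∣y'

module _ {w : ℤ} (2∤w : ¬ (+ 2 ∣ w)) where

  private
    2∤odd*w : ∀ m → ¬ (+ 2 ∣ (m + m + 1ℤ) * w)
    2∤odd*w m 2∣ = [ 2∤odd m , 2∤w ]′ (euclidsLemmaℤ prime[2] (m + m + 1ℤ) w 2∣)

    -- a ≡ 3a' ≡ 3 (mod 4) is impossible for a sum of two squares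
    a'≡1-mod4 : ∀ {a a' k'} → S 2 a → + a' ≡ + 4 * k' + 1ℤ → ¬ (+ 4 ∣ (+ a - + 3 * + a') * w)
    a'≡1-mod4 {a} {a'} {k'} Sa a'≡ 4∣ = [ a-odd , a-even ]′ (S₂-cases Sa)
      where
      both-odd : ∀ k k' w → (+ 4 * k + 1ℤ - + 3 * (+ 4 * k' + 1ℤ)) * w ≡
                            + 2 * (((k - + 3 * k' - 1ℤ) + (k - + 3 * k' - 1ℤ) + 1ℤ) * w)
      both-odd = solve-∀
      even-odd : ∀ b k' w → (+ 2 * b - + 3 * (+ 4 * k' + 1ℤ)) * w ≡
                            ((b - + 6 * k' - + 2) + (b - + 6 * k' - + 2) + 1ℤ) * w
      even-odd = solve-∀
      a-odd : (∃ λ k → + a ≡ + 4 * k + 1ℤ) → ⊥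
      a-odd (k , a≡) = 2∤odd*w (k - + 3 * k' - 1ℤ) (*-cancelˡ-∣ (+ 2) (subst (+ 4 ∣_)
        (trans (cong₂ (λ A A' → (A - + 3 * A') * w) a≡ a'≡) (both-odd k k' w)) 4∣))
      a-even : (∃ λ b → a ≡ 2 ℕ.* b × S 2 b) → ⊥
      a-even (b , refl , _) = 2∤odd*w (+ b - + 6 * k' - + 2) (subst (+ 2 ∣_)
        (trans (cong₂ (λ A A' → (A - + 3 * A') * w) (ℤ.pos-* 2 b) a'≡) (even-odd (+ b) k' w))
        (∣-trans (divides (+ 2) refl) 4∣))

    halve-both : ∀ {a b'} → S 2 a → + 4 * + (2 ℕ.* b') ∣ (+ a - + 3 * + (2 ℕ.* b')) * w →
                 ∃ λ b → S 2 b × + 4 * + b' ∣ (+ b - + 3 * + b') * w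
    halve-both {a} {b'} Sa h = [ a-odd , a-even ]′ (S₂-cases Sa)
      where
      odd-even : ∀ k b' w → (+ 4 * k + 1ℤ - + 3 * (+ 2 * b')) * w + + 2 * (+ 3 * b' * w) ≡
                            ((k + k) + (k + k) + 1ℤ) * w
      odd-even = solve-∀
      double : ∀ b b' w → + 4 * (+ 2 * b') ∣ (+ 2 * b - + 3 * (+ 2 * b')) * w →
                          + 2 * (+ 4 * b') ∣ + 2 * ((b - + 3 * b') * w)
      double b b' w = subst₂ _∣_ (4*2b' b') (2b-6b' b b' w)
        where
        4*2b' : ∀ b' → + 4 * (+ 2 * b') ≡ + 2 * (+ 4 * b')
        4*2b' = solve-∀
        2b-6b' : ∀ b b' w → (+ 2 * b - + 3 * (+ 2 * b')) * w ≡ + 2 * ((b - + 3 * b') * w)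
        2b-6b' = solve-∀
      a-odd : (∃ λ k → + a ≡ + 4 * k + 1ℤ) → ∃ λ b → S 2 b × + 4 * + b' ∣ (+ b - + 3 * + b') * w
      a-odd (k , a≡) = ⊥-elim (2∤odd*w (k + k) (subst (+ 2 ∣_)
        (trans (cong₂ (λ A A' → (A - + 3 * A') * w + + 2 * (+ 3 * + b' * w)) a≡ (ℤ.pos-* 2 b'))
               (odd-even k (+ b') w))
        (∣m∣n⇒∣m+n (∣-trans (∣m⇒∣m*n (+ (2 ℕ.* b')) (divides (+ 2) refl)) h)
                   (∣m⇒∣m*n (+ 3 * + b' * w) ∣-refl))))
      a-even : (∃ λ b → a ≡ 2 ℕ.* b × S 2 b) → ∃ λ b → S 2 b × + 4 * + b' ∣ (+ b - + 3 * + b') * w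
      a-even (b , refl , Sb) = b , Sb , *-cancelˡ-∣ (+ 2) (double (+ b) (+ b') w
        (subst₂ (λ B B' → + 4 * B' ∣ (B - + 3 * B') * w) (ℤ.pos-* 2 b) (ℤ.pos-* 2 b') h))

  3-not-approximable : ∀ {a a'} → Acc _<_ a' → S 2 a → S 2 a' → + 4 * + a' ∣ (+ a - + 3 * + a') * w → ⊥
  3-not-approximable {a} {a'} (acc rec) Sa Sa' h = [ a'-odd , a'-even ]′ (S₂-cases Sa')
    where
    a'-odd : (∃ λ k' → + a' ≡ + 4 * k' + 1ℤ) → ⊥
    a'-odd (k' , a'≡) = a'≡1-mod4 {a} {a'} {k'} Sa a'≡ (∣-trans (∣m⇒∣m*n (+ a') ∣-refl) h)
    a'-even : (∃ λ b' → a' ≡ 2 ℕ.* b' × S 2 b') → ⊥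
    a'-even (b' , refl , Sb') =
      let b , Sb , h' = halve-both {a} {b'} Sa h
      in 3-not-approximable {b} {b'} (rec (x<k*x ℕ.≤-refl (proj₁ Sb'))) Sb Sb' h'

S₂-¬ratiosDense[2] : ¬ RatiosDenseInQp 2 (S 2)
S₂-¬ratiosDense[2] dense =
  let a , a' , Sa , Sa' , w , 2∤w , close = ratiosDense⇒approximates dense (+ 3) 2
  in 3-not-approximable 2∤w (<-wellFounded a') Sa Sa' close

-- Fixed points of an involution

module _ {X : Set} (_≟_ : DecidableEquality X) where

  remove : X → List X → List X
  remove x = filter (λ y → ¬? (y ≟ x))

  length-remove : ∀ {x xs} → Unique xs → x ∈ xs → length xs ≡ suc (length (remove x xs))
  length-remove {x} {x ∷ xs} (x∉xs ∷ _) (here refl) =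
    cong suc (sym (trans (cong length (filter-reject (λ y → ¬? (y ≟ x)) (λ x≢x → x≢x refl)))
                         (cong length (filter-all (λ y → ¬? (y ≟ x)) (All.map (λ x≢y → x≢y ∘ sym) x∉xs)))))
  length-remove {x} {y ∷ xs} (y∉xs ∷ u) (there x∈xs) =
    trans (cong suc (length-remove u x∈xs))
          (cong (suc ∘ length) (sym (filter-accept (λ z → ¬? (z ≟ x)) {y} {xs} (All.lookup y∉xs x∈xs))))

  ∈-remove⁻ : ∀ {x y xs} → y ∈ remove x xs → y ∈ xs × y ≢ x
  ∈-remove⁻ {x} = ∈-filter⁻ (λ y → ¬? (y ≟ x))

  module _ (g : X → X) where

    fixedPoints : List X → List X
    fixedPoints = filter (λ x → g x ≟ x)

    IsInvolutionOn : List X → Set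
    IsInvolutionOn xs = ∀ {x} → x ∈ xs → g x ∈ xs × g (g x) ≡ x

    fixedPoints-remove : ∀ {z} → g z ≢ z → ∀ xs → fixedPoints (remove z xs) ≡ fixedPoints xs
    fixedPoints-remove gz≢z [] = refl
    fixedPoints-remove {z} gz≢z (y ∷ xs) with y ≟ z
    ... | yes refl = trans (fixedPoints-remove gz≢z xs) (sym (filter-reject (λ x → g x ≟ x) gz≢z))
    ... | no _ with g y ≟ y
    ...   | yes _ = cong (y ∷_) (fixedPoints-remove gz≢z xs)
    ...   | no _  = fixedPoints-remove gz≢z xs

    involution-drop-fixed : ∀ {x xs} → All (x ≢_) xs → g x ≡ x → IsInvolutionOn (x ∷ xs) → IsInvolutionOn xs
    involution-drop-fixed x∉xs gx≡x inv {y} y∈xs with inv (there y∈xs)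
    ... | here gy≡x , ggy≡y   =
      ⊥-elim (All.lookup x∉xs y∈xs (trans (sym gx≡x) (trans (cong g (sym gy≡x)) ggy≡y)))
    ... | there gy∈xs , ggy≡y = gy∈xs , ggy≡y

    involution-drop-pair : ∀ {x xs} → All (x ≢_) xs → IsInvolutionOn (x ∷ xs) → IsInvolutionOn (remove (g x) xs)
    involution-drop-pair {x} x∉xs inv {y} y∈zs with ∈-remove⁻ y∈zs
    ... | y∈xs , y≢gx with inv (there y∈xs)
    ...   | here gy≡x , ggy≡y   = ⊥-elim (y≢gx (trans (sym ggy≡y) (cong g gy≡x)))
    ...   | there gy∈xs , ggy≡y = ∈-filter⁺ (λ y → ¬? (y ≟ g x)) gy∈xs gy≢gx , ggy≡y
      where
      gy≢gx : g y ≢ g x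
      gy≢gx gy≡gx =
        All.lookup x∉xs y∈xs (trans (sym (proj₂ (inv (here refl)))) (trans (cong g (sym gy≡gx)) ggy≡y))

    parity-fixedPoints : ∀ xs → Unique xs → IsInvolutionOn xs →
                         parity (length xs) ≡ parity (length (fixedPoints xs))
    parity-fixedPoints xs = go xs (<-wellFounded (length xs))
      where
      go : ∀ xs → Acc _<_ (length xs) → Unique xs → IsInvolutionOn xs →
           parity (length xs) ≡ parity (length (fixedPoints xs))
      go []       _         _               _   = refl
      go (x ∷ xs) (acc rec) (x∉xs ∷ unique) inv with g x ≟ x | inv (here refl)
      ... | yes gx≡x | _ = parity-suc {length xs} {length (fixedPoints xs)}
                             (go xs (rec (ℕ.n<1+n _)) unique (involution-drop-fixed x∉xs gx≡x inv))
      ... | no gx≢x | here gx≡x , _ = ⊥-elim (gx≢x gx≡x)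
      ... | no gx≢x | there gx∈xs , ggx≡x = begin
        parity (suc (length xs))           ≡⟨ cong (parity ∘ suc) (length-remove unique gx∈xs) ⟩
        parity (length zs)
          ≡⟨ go zs (rec zs<) (Unique.filter⁺ _ unique) (involution-drop-pair x∉xs inv) ⟩
        parity (length (fixedPoints zs))   ≡⟨ cong (parity ∘ length) (fixedPoints-remove ggx≢gx xs) ⟩
        parity (length (fixedPoints xs))   ∎
        where
        open ≡-Reasoning
        zs = remove (g x) xs
        zs< : length zs < suc (length xs)
        zs< = subst (length zs <_) (cong suc (sym (length-remove unique gx∈xs))) (ℕ.m<n⇒m<1+n (ℕ.n<1+n _))
        ggx≢gx : g (g x) ≢ g x
        ggx≢gx ggx≡gx = gx≢x (sym (trans (sym ggx≡x) ggx≡gx))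

-- Odd primes

-- with ‖v‖² ≡ -s², ((t+1)s)² + (t-1)²‖v‖² ≡ ((t+1)² - (t-1)²) s² = t (2s)²; the first square is
-- shifted by Q = p^K to make the sum positive
approximation-identity : ∀ X⁺ Q t s N e → X⁺ * X⁺ ≡ (t + 1ℤ) * s * ((t + 1ℤ) * s) → N + s * s ≡ e * Q →
  (X⁺ + Q) * (X⁺ + Q) + (t - 1ℤ) * (t - 1ℤ) * N - t * (+ 2 * s * (+ 2 * s)) ≡
  (+ 2 * X⁺ + Q + (t - 1ℤ) * (t - 1ℤ) * e) * Q
approximation-identity X⁺ Q t s N e X⁺²≡ E≡ = begin
  (X⁺ + Q) * (X⁺ + Q) + (t - 1ℤ) * (t - 1ℤ) * N - t * (+ 2 * s * (+ 2 * s))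
    ≡⟨ split X⁺ Q t s N e ⟩
  R + (X⁺ * X⁺ - (t + 1ℤ) * s * ((t + 1ℤ) * s)) + (t - 1ℤ) * (t - 1ℤ) * (N + s * s - e * Q)
    ≡⟨ cong₂ (λ d d' → R + d + (t - 1ℤ) * (t - 1ℤ) * d') (ℤ.i≡j⇒i-j≡0 X⁺²≡) (ℤ.i≡j⇒i-j≡0 E≡) ⟩
  R + 0ℤ + (t - 1ℤ) * (t - 1ℤ) * 0ℤ
    ≡⟨ drop-zeros R ((t - 1ℤ) * (t - 1ℤ)) ⟩
  R ∎
  where
  open ≡-Reasoning
  R = (+ 2 * X⁺ + Q + (t - 1ℤ) * (t - 1ℤ) * e) * Q
  split : ∀ X⁺ Q t s N e →
    (X⁺ + Q) * (X⁺ + Q) + (t - 1ℤ) * (t - 1ℤ) * N - t * (+ 2 * s * (+ 2 * s)) ≡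
    (+ 2 * X⁺ + Q + (t - 1ℤ) * (t - 1ℤ) * e) * Q + (X⁺ * X⁺ - (t + 1ℤ) * s * ((t + 1ℤ) * s))
      + (t - 1ℤ) * (t - 1ℤ) * (N + s * s - e * Q)
  split = solve-∀
  drop-zeros : ∀ z c → z + 0ℤ + c * 0ℤ ≡ z
  drop-zeros = solve-∀

module OddPrime {p : ℕ} (p-prime : Prime p) (h : ℕ) (p≡2h+1 : p ≡ suc (h ℕ.+ h)) where

  private
    P = + p
    instance
      p≢0 : NonZero p
      p≢0 = prime⇒nonZero p-prime

  h+h<p : h ℕ.+ h < p
  h+h<p = subst (h ℕ.+ h <_) (sym p≡2h+1) ℕ.≤-refl

  h<p : h < p
  h<p = ℕ.≤-<-trans (ℕ.m≤m+n h h) h+h<p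

  1≤h : 1 ≤ h
  1≤h = positive h p≡2h+1
    where
    positive : ∀ n → p ≡ suc (n ℕ.+ n) → 1 ≤ n
    positive zero    p≡1 = ⊥-elim (ℕ.<-irrefl (sym p≡1) (prime>1 p-prime))
    positive (suc _) _   = s≤s z≤n

  P∤2 : ¬ (P ∣ + 2)
  P∤2 P∣2 with ∣-small⇒≡0 (ℕ.≤-<-trans (ℕ.+-mono-≤ 1≤h 1≤h) h+h<p) P∣2
  ... | ()

  infix 4 _≡±_
  data _≡±_ (x y : ℤ) : Set where
    same     : P ∣ x - y → x ≡± y
    opposite : P ∣ x + y → x ≡± y

  ≡±-sym : ∀ {x y} → x ≡± y → y ≡± x
  ≡±-sym {x} {y} (same P∣x-y) = same (subst (P ∣_) (negate x y) (∣m⇒∣-m P∣x-y))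
    where
    negate : ∀ x y → - (x - y) ≡ y - x
    negate = solve-∀
  ≡±-sym {x} {y} (opposite P∣x+y) = opposite (subst (P ∣_) (ℤ.+-comm x y) P∣x+y)

  ≡±-trans : ∀ {x y z} → x ≡± y → y ≡± z → x ≡± z
  ≡±-trans {x} {y} {z} (same P∣x-y) (same P∣y-z) =
    same (subst (P ∣_) (chain x y z) (∣m∣n⇒∣m+n P∣x-y P∣y-z))
    where
    chain : ∀ x y z → x - y + (y - z) ≡ x - z
    chain = solve-∀
  ≡±-trans {x} {y} {z} (same P∣x-y) (opposite P∣y+z) =
    opposite (subst (P ∣_) (chain x y z) (∣m∣n⇒∣m+n P∣x-y P∣y+z))
    where
    chain : ∀ x y z → x - y + (y + z) ≡ x + z
    chain = solve-∀
  ≡±-trans {x} {y} {z} (opposite P∣x+y) (same P∣y-z) =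
    opposite (subst (P ∣_) (chain x y z) (∣m∣n⇒∣m-n P∣x+y P∣y-z))
    where
    chain : ∀ x y z → x + y - (y - z) ≡ x + z
    chain = solve-∀
  ≡±-trans {x} {y} {z} (opposite P∣x+y) (opposite P∣y+z) =
    same (subst (P ∣_) (chain x y z) (∣m∣n⇒∣m-n P∣x+y P∣y+z))
    where
    chain : ∀ x y z → x + y - (y + z) ≡ x - z
    chain = solve-∀

  private
    *-distribˡ-- : ∀ c x y → c * (x - y) ≡ c * x - c * y
    *-distribˡ-- = solve-∀

  ≡±-*ˡ : ∀ c {x y} → x ≡± y → c * x ≡± c * y
  ≡±-*ˡ c {x} {y} (same P∣x-y) = same (subst (P ∣_) (*-distribˡ-- c x y) (∣n⇒∣m*n c P∣x-y))
  ≡±-*ˡ c {x} {y} (opposite P∣x+y) = opposite (subst (P ∣_) (ℤ.*-distribˡ-+ c x y) (∣n⇒∣m*n c P∣x+y))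

  ≡±-cancelˡ : ∀ {c x y} → ¬ (P ∣ c) → c * x ≡± c * y → x ≡± y
  ≡±-cancelˡ {c} {x} {y} P∤c (same P∣cx-cy) =
    same ([ ⊥-elim ∘ P∤c , id ]′
          (euclidsLemmaℤ p-prime c (x - y) (subst (P ∣_) (sym (*-distribˡ-- c x y)) P∣cx-cy)))
  ≡±-cancelˡ {c} {x} {y} P∤c (opposite P∣cx+cy) =
    opposite ([ ⊥-elim ∘ P∤c , id ]′
          (euclidsLemmaℤ p-prime c (x + y) (subst (P ∣_) (sym (ℤ.*-distribˡ-+ c x y)) P∣cx+cy)))

  sq-≡± : ∀ x y → P ∣ x * x - y * y → x ≡± y
  sq-≡± x y P∣x²-y² =
    [ same , opposite ]′ (euclidsLemmaℤ p-prime (x - y) (x + y) (subst (P ∣_) (factor x y) P∣x²-y²))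
    where
    factor : ∀ x y → x * x - y * y ≡ (x - y) * (x + y)
    factor = solve-∀

  ≡±-sq : ∀ {x y} → x ≡± y → P ∣ x * x - y * y
  ≡±-sq {x} {y} (same P∣x-y) = subst (P ∣_) (factor x y) (∣m⇒∣m*n (x + y) P∣x-y)
    where
    factor : ∀ x y → (x - y) * (x + y) ≡ x * x - y * y
    factor = solve-∀
  ≡±-sq {x} {y} (opposite P∣x+y) = subst (P ∣_) (factor x y) (∣m⇒∣m*n (x - y) P∣x+y)
    where
    factor : ∀ x y → (x + y) * (x - y) ≡ x * x - y * y
    factor = solve-∀

  ≡±-unique : ∀ {x y} → x ≤ h → y ≤ h → + x ≡± + y → x ≡ y
  ≡±-unique {x} {y} x≤h y≤h (same P∣x-y) =
    ℤ.+-injective (ℤ.i-j≡0⇒i≡j (+ x) (+ y) (∣-small⇒≡0 ∣x-y∣<p P∣x-y))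
    where
    ∣x-y∣<p : ∣ + x - + y ∣ < p
    ∣x-y∣<p = ℕ.≤-<-trans (subst (ℕ._≤ x ℕ.⊔ y) (cong ∣_∣ (sym (ℤ.m-n≡m⊖n x y)))
                                 (ℤ.∣m⊝n∣≤m⊔n x y))
                          (ℕ.≤-<-trans (ℕ.⊔-lub x≤h y≤h) h<p)
  ≡±-unique {x} {y} x≤h y≤h (opposite P∣x+y) =
    trans (ℕ.m+n≡0⇒m≡0 x x+y≡0) (sym (ℕ.m+n≡0⇒n≡0 x x+y≡0))
    where
    x+y≡0 : x ℕ.+ y ≡ 0
    x+y≡0 = ℤ.+-injective (∣-small⇒≡0 (ℕ.≤-<-trans (ℕ.+-mono-≤ x≤h y≤h) h+h<p)
                                       (subst (P ∣_) (sym (ℤ.pos-+ x y)) P∣x+y))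

  Half : ℕ → Set
  Half x = 1 ≤ x × x ≤ h

  half? : ∀ x → Dec (Half x)
  half? x = (1 ℕ.≤? x) ×-dec (x ℕ.≤? h)

  P∤half : ∀ {x} → Half x → ¬ (P ∣ + x)
  P∤half {suc x} (_ , x≤h) P∣x with ∣-small⇒≡0 (ℕ.≤-<-trans x≤h h<p) P∣x
  ... | ()

  ≡±-representative : ∀ z → ¬ (P ∣ z) → ∃ λ y → Half y × z ≡± + y
  ≡±-representative z P∤z = reduce (z ℤ.%ℕ p) (ℤ.n%ℕd<d z p) (ℤ.a≡a%ℕn+[a/ℕn]*n z p)
    where
    reduce : ∀ r → r < p → z ≡ + r + (z ℤ./ℕ p) * P → ∃ λ y → Half y × z ≡± + y
    reduce r r<p z≡ = fold (r ℕ.≤? h)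
      where
      P∣z-r : P ∣ z - + r
      P∣z-r = divides (z ℤ./ℕ p) (trans (cong (_- + r) z≡) (cancel (+ r) (z ℤ./ℕ p * P)))
        where
        cancel : ∀ r q → r + q - r ≡ q
        cancel = solve-∀
      r≢0 : r ≢ 0
      r≢0 refl = P∤z (subst (P ∣_) (ℤ.+-identityʳ z) P∣z-r)
      fold : Dec (r ≤ h) → ∃ λ y → Half y × z ≡± + y
      fold (yes r≤h) = r , (ℕ.n≢0⇒n>0 r≢0 , r≤h) , same P∣z-r
      fold (no r≰h)  = p ℕ.∸ r , (ℕ.m<n⇒0<n∸m r<p , p-r≤h) , opposite P∣z+[p-r]
        where
        p-r≤h : p ℕ.∸ r ≤ h
        p-r≤h = subst (λ q → q ℕ.∸ r ≤ h) (sym p≡2h+1)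
                  (ℕ.≤-trans (ℕ.∸-monoʳ-≤ (suc (h ℕ.+ h)) (ℕ.≰⇒> r≰h))
                             (ℕ.≤-reflexive (ℕ.m+n∸n≡m h h)))
        P∣z+[p-r] : P ∣ z + + (p ℕ.∸ r)
        P∣z+[p-r] = subst (P ∣_)
          (trans (add-p z (+ r) P) (cong (λ q → z + q) (trans (ℤ.m-n≡m⊖n p r) (ℤ.⊖-≥ (ℕ.<⇒≤ r<p)))))
          (∣m∣n⇒∣m+n P∣z-r ∣-refl)
          where
          add-p : ∀ z r P → z - r + P ≡ z + (P - r)
          add-p = solve-∀

  inverse± : ∀ {x} → Half x → ∃ λ y → Half y × + x * + y ≡± 1ℤ
  inverse± {x} half-x =
    let v , P∣xv-1 = inverseMod p-prime (λ p∣x → P∤half half-x (∣ᵤ⇒∣ p∣x))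
        P∤v : ¬ (P ∣ v)
        P∤v P∣v = prime∤1 p-prime
          (subst (P ∣_) (cancel (+ x) v) (∣m∣n⇒∣m-n (∣n⇒∣m*n (+ x) P∣v) P∣xv-1))
        y , half-y , v≡±y = ≡±-representative v P∤v
    in y , half-y , ≡±-trans (≡±-sym (≡±-*ˡ (+ x) v≡±y)) (same P∣xv-1)
    where
    cancel : ∀ x v → x * v - (x * v - 1ℤ) ≡ 1ℤ
    cancel = solve-∀

  inverse±-unique : ∀ {x y y'} → Half x → Half y → Half y' →
                    + x * + y ≡± 1ℤ → + x * + y' ≡± 1ℤ → y ≡ y'
  inverse±-unique half-x (_ , y≤h) (_ , y'≤h) xy≡±1 xy'≡±1 =
    ≡±-unique y≤h y'≤h (≡±-cancelˡ (P∤half half-x) (≡±-trans xy≡±1 (≡±-sym xy'≡±1)))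

  inv± : ℕ → ℕ
  inv± x with half? x
  ... | yes half-x = proj₁ (inverse± half-x)
  ... | no _       = x

  inv±-spec : ∀ {x} → Half x → Half (inv± x) × + x * + inv± x ≡± 1ℤ
  inv±-spec {x} half-x with half? x
  ... | yes half-x' = proj₂ (inverse± half-x')
  ... | no ¬half-x  = ⊥-elim (¬half-x half-x)

  inv±-unique : ∀ {x y} → Half x → Half y → + x * + y ≡± 1ℤ → inv± x ≡ y
  inv±-unique half-x half-y xy≡±1 =
    inverse±-unique half-x (proj₁ (inv±-spec half-x)) half-y (proj₂ (inv±-spec half-x)) xy≡±1

  inv±-involutive : ∀ {x} → Half x → inv± (inv± x) ≡ x
  inv±-involutive {x} half-x =
    inv±-unique (proj₁ (inv±-spec half-x)) half-x
                (subst (_≡± 1ℤ) (ℤ.*-comm (+ x) (+ inv± x)) (proj₂ (inv±-spec half-x)))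

  inv±-fixed : ∀ {x} → Half x → inv± x ≡ x → x ≡ 1 ⊎ P ∣ + x * + x + 1ℤ
  inv±-fixed {x} half-x x↦x with subst (λ y → + x * + y ≡± 1ℤ) x↦x (proj₂ (inv±-spec half-x))
  ... | same P∣x²-1 =
    inj₁ (≡±-unique (proj₂ half-x) (ℕ.≤-trans (proj₁ half-x) (proj₂ half-x)) (sq-≡± (+ x) 1ℤ P∣x²-1))
  ... | opposite P∣x²+1 = inj₂ P∣x²+1

  private
    L : List ℕ
    L = applyUpTo suc h

    ∈L⁻ : ∀ {x} → x ∈ L → Half x
    ∈L⁻ x∈L with ∈-applyUpTo⁻ suc x∈L
    ... | i , i<h , refl = s≤s z≤n , i<h

    ∈L⁺ : ∀ {x} → Half x → x ∈ L
    ∈L⁺ {suc i} (_ , i<h) = ∈-applyUpTo⁺ suc i<h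

    unique-L : Unique L
    unique-L = Unique.applyUpTo⁺₁ suc h (λ i<j _ → ℕ.<⇒≢ i<j ∘ ℕ.suc-injective)

    F : List ℕ
    F = fixedPoints ℕ._≟_ inv± L

    half-1 : Half 1
    half-1 = ℕ.≤-refl , 1≤h

    1∈F : 1 ∈ F
    1∈F = ∈-filter⁺ (λ x → inv± x ℕ.≟ x) (∈L⁺ half-1) (inv±-unique half-1 half-1 (same (divides 0ℤ refl)))

    Root : ℕ → Set
    Root z = Half z × P ∣ + z * + z + 1ℤ

    roots : List ℕ
    roots = remove ℕ._≟_ 1 F

    unique-F : Unique F
    unique-F = Unique.filter⁺ (λ x → inv± x ℕ.≟ x) unique-L

    -- the fixed points of inv± are 1 and the square roots of -1 in [1, h], of which there is at most one
    parity-h : parity h ≡ parity (suc (length roots))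
    parity-h = begin
      parity h            ≡⟨ cong parity (sym (length-applyUpTo suc h)) ⟩
      parity (length L)   ≡⟨ parity-fixedPoints ℕ._≟_ inv± L unique-L
                               (λ x∈L → ∈L⁺ (proj₁ (inv±-spec (∈L⁻ x∈L))) , inv±-involutive (∈L⁻ x∈L)) ⟩
      parity (length F)   ≡⟨ cong parity (length-remove ℕ._≟_ unique-F 1∈F) ⟩
      parity (suc (length roots)) ∎
      where open ≡-Reasoning

    root-of-roots : ∀ {z} → z ∈ roots → Root z
    root-of-roots z∈roots with ∈-remove⁻ ℕ._≟_ z∈roots
    ... | z∈F , z≢1 with ∈-filter⁻ (λ x → inv± x ℕ.≟ x) {xs = L} z∈F
    ...   | z∈L , gz≡z with inv±-fixed (∈L⁻ z∈L) gz≡z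
    ...     | inj₁ z≡1 = ⊥-elim (z≢1 z≡1)
    ...     | inj₂ P∣z²+1 = ∈L⁻ z∈L , P∣z²+1

    roots-equal : ∀ {z z'} → Root z → Root z' → z ≡ z'
    roots-equal {z} {z'} (half-z , P∣z²+1) (half-z' , P∣z'²+1) =
      ≡±-unique (proj₂ half-z) (proj₂ half-z') (sq-≡± (+ z) (+ z')
        (subst (P ∣_) (difference (+ z * + z) (+ z' * + z')) (∣m∣n⇒∣m-n P∣z²+1 P∣z'²+1)))
      where
      difference : ∀ s t → s + 1ℤ - (t + 1ℤ) ≡ s - t
      difference = solve-∀

    root∈roots : ∀ {z} → Root z → z ∈ roots
    root∈roots {z} (half-z , P∣z²+1) = ∈-filter⁺ (λ y → ¬? (y ℕ.≟ 1)) z∈F z≢1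
      where
      z∈F : z ∈ F
      z∈F = ∈-filter⁺ (λ x → inv± x ℕ.≟ x) (∈L⁺ half-z) (inv±-unique half-z half-z (opposite P∣z²+1))
      z≢1 : z ≢ 1
      z≢1 refl = P∤2 P∣z²+1

  reduce-root : ∀ z → P ∣ z * z + 1ℤ → ∃ λ y → Half y × P ∣ + y * + y + 1ℤ
  reduce-root z P∣z²+1 =
    let P∤z : ¬ (P ∣ z)
        P∤z P∣z = prime∤1 p-prime (subst (P ∣_) (cancel z) (∣m∣n⇒∣m-n P∣z²+1 (∣m⇒∣m*n z P∣z)))
        y , half-y , z≡±y = ≡±-representative z P∤z
    in y , half-y , subst (P ∣_) (difference z (+ y)) (∣m∣n⇒∣m-n P∣z²+1 (≡±-sq z≡±y))
    where
    cancel : ∀ z → z * z + 1ℤ - z * z ≡ 1ℤ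
    cancel = solve-∀
    difference : ∀ z y → z * z + 1ℤ - (z * z - y * y) ≡ y * y + 1ℤ
    difference = solve-∀

  h-even⇒minusOneSquare : parity h ≡ 0ℙ → ∃ λ z → P ∣ z * z + 1ℤ
  h-even⇒minusOneSquare even = from (roots , refl)
    where
    from : (∃ λ zs → roots ≡ zs) → ∃ λ z → P ∣ z * z + 1ℤ
    from ([] , roots≡) with trans (trans (sym even) parity-h) (cong (parity ∘ suc ∘ length) roots≡)
    ... | ()
    from (z ∷ _ , roots≡) = + z , proj₂ (root-of-roots (subst (z ∈_) (sym roots≡) (here refl)))

  minusOneSquare⇒h-even : (∃ λ z → P ∣ z * z + 1ℤ) → parity h ≡ 0ℙ
  minusOneSquare⇒h-even (z , P∣z²+1) = from (reduce-root z P∣z²+1) (roots , refl)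
    where
    from : ∃ Root → (∃ λ zs → roots ≡ zs) → parity h ≡ 0ℙ
    from (y , root-y) ([] , roots≡) with subst (y ∈_) roots≡ (root∈roots root-y)
    ... | ()
    from _ (_ ∷ [] , roots≡) = trans parity-h (cong (parity ∘ suc ∘ length) roots≡)
    from _ (z₁ ∷ z₂ ∷ _ , roots≡) with subst Unique roots≡ (Unique.filter⁺ (λ y → ¬? (y ℕ.≟ 1)) unique-F)
    ... | (z₁≢z₂ ∷ _) ∷ _ = ⊥-elim (z₁≢z₂ (roots-equal
      (root-of-roots (subst (z₁ ∈_) (sym roots≡) (here refl)))
      (root-of-roots (subst (z₂ ∈_) (sym roots≡) (there (here refl))))))

  private
    residue : ℤ → Fin p
    residue z = fromℕ< (ℤ.n%ℕd<d z p)

    residue-≡ : ∀ u v → residue u ≡ residue v → P ∣ u - v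
    residue-≡ u v ru≡rv = divides (u ℤ./ℕ p - v ℤ./ℕ p) (begin
      u - v
        ≡⟨ cong₂ _-_ (ℤ.a≡a%ℕn+[a/ℕn]*n u p) (ℤ.a≡a%ℕn+[a/ℕn]*n v p) ⟩
      + (u ℤ.%ℕ p) + u ℤ./ℕ p * P - (+ (v ℤ.%ℕ p) + v ℤ./ℕ p * P)
        ≡⟨ cong (λ r → + (u ℤ.%ℕ p) + u ℤ./ℕ p * P - (+ r + v ℤ./ℕ p * P)) (sym %u≡%v) ⟩
      + (u ℤ.%ℕ p) + u ℤ./ℕ p * P - (+ (u ℤ.%ℕ p) + v ℤ./ℕ p * P)
        ≡⟨ cancel (+ (u ℤ.%ℕ p)) (u ℤ./ℕ p) (v ℤ./ℕ p) P ⟩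
      (u ℤ./ℕ p - v ℤ./ℕ p) * P ∎)
      where
      open ≡-Reasoning
      %u≡%v : u ℤ.%ℕ p ≡ v ℤ.%ℕ p
      %u≡%v = trans (sym (Fin.toℕ-fromℕ< (ℤ.n%ℕd<d u p)))
                    (trans (cong toℕ ru≡rv) (Fin.toℕ-fromℕ< (ℤ.n%ℕd<d v p)))
      cancel : ∀ r q q' P → r + q * P - (r + q' * P) ≡ (q - q') * P
      cancel = solve-∀

    -- the squares x² and the numbers -1 - y², for 0 ≤ x, y ≤ h: p + 1 values in p residue classes
    value : Fin (suc h) ⊎ Fin (suc h) → ℤ
    value (inj₁ a) = + toℕ a * + toℕ a
    value (inj₂ b) = - 1ℤ - + toℕ b * + toℕ b

    square-injective : ∀ (a b : Fin (suc h)) → P ∣ + toℕ a * + toℕ a - + toℕ b * + toℕ b → a ≡ b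
    square-injective a b P∣a²-b² = Fin.toℕ-injective
      (≡±-unique (ℕ.≤-pred (Fin.toℕ<n a)) (ℕ.≤-pred (Fin.toℕ<n b)) (sq-≡± (+ toℕ a) (+ toℕ b) P∣a²-b²))

    collision : ∀ u v → u ≢ v → P ∣ value u - value v → ∃₂ λ x y → P ∣ x * x + y * y + 1ℤ
    collision (inj₁ a) (inj₁ b) a≢b P∣ = ⊥-elim (a≢b (cong inj₁ (square-injective a b P∣)))
    collision (inj₂ a) (inj₂ b) a≢b P∣ =
      ⊥-elim (a≢b (cong inj₂ (sym (square-injective b a (subst (P ∣_) (swap (+ toℕ a) (+ toℕ b)) P∣)))))
      where
      swap : ∀ a b → - 1ℤ - a * a - (- 1ℤ - b * b) ≡ b * b - a * a
      swap = solve-∀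
    collision (inj₁ a) (inj₂ b) _ P∣ = + toℕ a , + toℕ b , subst (P ∣_) (rearrange (+ toℕ a) (+ toℕ b)) P∣
      where
      rearrange : ∀ a b → a * a - (- 1ℤ - b * b) ≡ a * a + b * b + 1ℤ
      rearrange = solve-∀
    collision (inj₂ a) (inj₁ b) _ P∣ =
      + toℕ b , + toℕ a , subst (P ∣_) (rearrange (+ toℕ a) (+ toℕ b)) (∣m⇒∣-m P∣)
      where
      rearrange : ∀ a b → - (- 1ℤ - a * a - b * b) ≡ b * b + a * a + 1ℤ
      rearrange = solve-∀

  minusOneSumOfTwoSquares : ∃₂ λ x y → P ∣ x * x + y * y + 1ℤ
  minusOneSumOfTwoSquares =
    let i , j , i<j , fi≡fj = Fin.pigeonhole p<2h+2 (residue ∘ value ∘ splitAt (suc h))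
    in collision (splitAt (suc h) i) (splitAt (suc h) j)
         (λ si≡sj → ℕ.<⇒≢ i<j (cong toℕ (trans (sym (Fin.join-splitAt (suc h) (suc h) i))
           (trans (cong (join (suc h) (suc h)) si≡sj) (Fin.join-splitAt (suc h) (suc h) j)))))
         (residue-≡ (value (splitAt (suc h) i)) (value (splitAt (suc h) j)) fi≡fj)
    where
    p<2h+2 : p < suc h ℕ.+ suc h
    p<2h+2 = subst (_< suc h ℕ.+ suc h) (sym p≡2h+1) (s≤s (ℕ.+-monoʳ-< h (ℕ.n<1+n h)))

  MinusOneSumOfSquares : ℕ → ℕ → Set
  MinusOneSumOfSquares k K = ∃₂ λ (v : Vec ℤ k) s → ¬ (P ∣ s) × + (p ^ K) ∣ sumSqℤ v + s * s

  -- (2sv)² + (s² - ‖v‖²)² = (‖v‖² + s²)², and squaring raises the p-adic valuation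
  minusOneSumOfSquares-lift : ∀ {k K} → MinusOneSumOfSquares k (suc K) → MinusOneSumOfSquares k (suc (suc K))
  minusOneSumOfSquares-lift {k} {K} (v , s , P∤s , divides e E≡) =
    V.map (+ 2 * s *_) v , s * s - N , P∤s' , divides (e * e * Q) (begin
      sumSqℤ (V.map (+ 2 * s *_) v) + (s * s - N) * (s * s - N)
        ≡⟨ cong (λ X → X + (s * s - N) * (s * s - N)) (sumSqℤ-map-* (+ 2 * s) v) ⟩
      + 2 * s * (+ 2 * s) * N + (s * s - N) * (s * s - N)       ≡⟨ square-of-norm s N ⟩
      (N + s * s) * (N + s * s)                                  ≡⟨ cong₂ _*_ E≡' E≡' ⟩
      e * (P * Q) * (e * (P * Q))                                ≡⟨ regroup e P Q ⟩
      e * e * Q * (P * (P * Q))                                  ≡⟨ cong (e * e * Q *_) (sym p^[2+K]) ⟩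
      e * e * Q * + (p ^ suc (suc K))                            ∎)
    where
    open ≡-Reasoning
    N = sumSqℤ v
    Q = + (p ^ K)
    E≡' : N + s * s ≡ e * (P * Q)
    E≡' = trans E≡ (cong (e *_) (ℤ.pos-* p (p ^ K)))
    p^[2+K] : + (p ^ suc (suc K)) ≡ P * (P * Q)
    p^[2+K] = trans (ℤ.pos-* p (p ^ suc K)) (cong (P *_) (ℤ.pos-* p (p ^ K)))
    square-of-norm : ∀ s N → + 2 * s * (+ 2 * s) * N + (s * s - N) * (s * s - N) ≡ (N + s * s) * (N + s * s)
    square-of-norm = solve-∀
    regroup : ∀ e P Q → e * (P * Q) * (e * (P * Q)) ≡ e * e * Q * (P * (P * Q))
    regroup = solve-∀
    P∤s' : ¬ (P ∣ s * s - N)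
    P∤s' P∣s²-N
      with euclidsLemmaℤ p-prime (+ 2) (s * s) (subst (P ∣_) (twice s N) (∣m∣n⇒∣m+n P∣s²-N P∣E))
      where
      P∣E : P ∣ N + s * s
      P∣E = subst (P ∣_) (sym E≡') (∣n⇒∣m*n e (∣m⇒∣m*n Q ∣-refl))
      twice : ∀ s N → s * s - N + (N + s * s) ≡ + 2 * (s * s)
      twice = solve-∀
    ... | inj₁ P∣2  = P∤2 P∣2
    ... | inj₂ P∣s² = P∤s (prime∣sq⇒∣ p-prime s P∣s²)

  minusOneSumOfSquares-all : ∀ {k} → MinusOneSumOfSquares k 1 → ∀ K → MinusOneSumOfSquares k K
  minusOneSumOfSquares-all (v , s , P∤s , _) zero = v , s , P∤s , divides (sumSqℤ v + s * s) (sym (ℤ.*-identityʳ _))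
  minusOneSumOfSquares-all base (suc zero)    = base
  minusOneSumOfSquares-all base (suc (suc K)) = minusOneSumOfSquares-lift {K = K} (minusOneSumOfSquares-all base (suc K))

  approximate : ∀ {k} t K → MinusOneSumOfSquares k K →
                ∃₂ λ a a' → S (suc k) a × S (suc k) a' × ¬ p ∣ℕ a' × + (p ^ K) ∣ + a - t * + a'
  approximate {k} t K (v , s , P∤s , divides e E≡) =
    sumSq xs , x' ℕ.* x' , (1≤a , xs , refl) , S-square (s≤s z≤n) 1≤x' , p∤a' ,
    divides (+ 2 * X⁺ + Q + (t - 1ℤ) * (t - 1ℤ) * e)
      (trans (cong₂ (λ a a' → a - t * a') +a≡ (+sq-abs (+ 2 * s)))
             (approximation-identity X⁺ Q t s N e (trans (sym (ℤ.pos-* ∣ X ∣ ∣ X ∣)) (+sq-abs X)) E≡))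
    where
    N = sumSqℤ v
    Q = + (p ^ K)
    X = (t + 1ℤ) * s
    X⁺ = + ∣ X ∣
    x₀ = ∣ X ∣ ℕ.+ p ^ K
    xs = x₀ ∷ V.map ∣_∣ (V.map ((t - 1ℤ) *_) v)
    x' = ∣ + 2 * s ∣

    +a≡ : + sumSq xs ≡ (X⁺ + Q) * (X⁺ + Q) + (t - 1ℤ) * (t - 1ℤ) * N
    +a≡ = trans (ℤ.pos-+ (x₀ ℕ.* x₀) _) (cong₂ _+_
            (trans (ℤ.pos-* x₀ x₀) (cong (λ y → y * y) (ℤ.pos-+ ∣ X ∣ (p ^ K))))
            (trans (+sumSq-map-abs (V.map ((t - 1ℤ) *_) v)) (sumSqℤ-map-* (t - 1ℤ) v)))

    1≤a : 1 ≤ sumSq xs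
    1≤a = ℕ.≤-trans (1≤sq (ℕ.≤-trans (ℕ.m^n>0 p K) (ℕ.m≤n+m (p ^ K) ∣ X ∣)))
                    (ℕ.m≤m+n (x₀ ℕ.* x₀) _)

    P∤2s : ¬ (P ∣ + 2 * s)
    P∤2s P∣2s = [ P∤2 , P∤s ]′ (euclidsLemmaℤ p-prime (+ 2) s P∣2s)

    1≤x' : 1 ≤ x'
    1≤x' = ∤⇒1≤∣∣ (+ 2 * s) P∤2s

    p∤a' : ¬ p ∣ℕ x' ℕ.* x'
    p∤a' p∣a' = P∤2s (∣ᵤ⇒∣ ([ id , id ]′ (euclidsLemma x' x' p-prime p∣a')))

  S-approximates : ∀ {k n} → suc k ≤ n → MinusOneSumOfSquares k 1 → ApproximatesIntegers p (S n)
  S-approximates k<n base t K =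
    let a , a' , Sa , Sa' , p∤a' , approx = approximate t K (minusOneSumOfSquares-all base K)
    in a , a' , S-≤ k<n Sa , S-≤ k<n Sa' , p∤a' , approx

  p%4 : (parity h ≡ 0ℙ × p % 4 ≡ 1) ⊎ (parity h ≡ 1ℙ × p % 4 ≡ 3)
  p%4 = subst (λ q → (parity h ≡ 0ℙ × q % 4 ≡ 1) ⊎ (parity h ≡ 1ℙ × q % 4 ≡ 3)) (sym p≡2h+1) (odd%4 h)

  minusOneSquare⇒p%4≡1 : (∃ λ z → P ∣ z * z + 1ℤ) → p % 4 ≡ 1
  minusOneSquare⇒p%4≡1 root =
    [ proj₂ , (λ (odd , _) → contradiction (trans (sym odd) (minusOneSquare⇒h-even root)) λ ()) ]′ p%4

  p%4≡1⇒minusOneSquare : p % 4 ≡ 1 → ∃ λ z → P ∣ z * z + 1ℤ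
  p%4≡1⇒minusOneSquare ≡1 =
    [ h-even⇒minusOneSquare ∘ proj₁ , (λ (_ , ≡3) → contradiction (trans (sym ≡1) ≡3) λ ()) ]′ p%4

  Sₙ-ratiosDense : 3 ≤ n → RatiosDenseInQp p (S n)
  Sₙ-ratiosDense 3≤n = approximatesIntegers⇒ratiosDense p-prime S-scale (S-approximates 3≤n base)
    where
    base : MinusOneSumOfSquares 2 1
    base = let x , y , P∣x²+y²+1 = minusOneSumOfTwoSquares
           in x ∷ y ∷ [] , 1ℤ , prime∤1 p-prime ,
              subst₂ _∣_ (cong +_ (sym (ℕ.*-identityʳ p))) (pad x y) P∣x²+y²+1
      where
      pad : ∀ x y → x * x + y * y + 1ℤ ≡ x * x + (y * y + 0ℤ) + 1ℤ * 1ℤ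
      pad = solve-∀

  S₂-ratiosDense : p % 4 ≡ 1 → RatiosDenseInQp p (S 2)
  S₂-ratiosDense ≡1 = approximatesIntegers⇒ratiosDense p-prime S-scale (S-approximates ℕ.≤-refl base)
    where
    base : MinusOneSumOfSquares 1 1
    base = let z , P∣z²+1 = p%4≡1⇒minusOneSquare ≡1
           in z ∷ [] , 1ℤ , prime∤1 p-prime , subst₂ _∣_ (cong +_ (sym (ℕ.*-identityʳ p))) (pad z) P∣z²+1
      where
      pad : ∀ z → z * z + 1ℤ ≡ z * z + 0ℤ + 1ℤ * 1ℤ
      pad = solve-∀

-- The prime 2

-- Hensel lifting for x² = T at p = 2: if 16·2ʲ ∤ x² - T, replace x by x + 4·2ʲ
oddSqrt-mod-2^ : ∀ T → + 8 ∣ T - 1ℤ → ∀ j → ∃ λ q → + 8 * + (2 ^ j) ∣ (q + q + 1ℤ) * (q + q + 1ℤ) - T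
oddSqrt-mod-2^ T 8∣T-1 zero = 0ℤ , subst (+ 8 ∣_) (negate T) (∣m⇒∣-m 8∣T-1)
  where
  negate : ∀ T → - (T - 1ℤ) ≡ (0ℤ + 0ℤ + 1ℤ) * (0ℤ + 0ℤ + 1ℤ) - T
  negate = solve-∀
oddSqrt-mod-2^ T 8∣T-1 (suc j) = lift (oddSqrt-mod-2^ T 8∣T-1 j)
  where
  Pj = + (2 ^ j)
  16Pj : + 8 * + (2 ^ suc j) ≡ + 16 * Pj
  16Pj = trans (cong (+ 8 *_) (ℤ.pos-* 2 (2 ^ j))) (sym (ℤ.*-assoc (+ 8) (+ 2) Pj))
  lift : (∃ λ q → + 8 * Pj ∣ (q + q + 1ℤ) * (q + q + 1ℤ) - T) →
         ∃ λ q → + 8 * + (2 ^ suc j) ∣ (q + q + 1ℤ) * (q + q + 1ℤ) - T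
  lift (q , divides k eq) = by-parity (parityℤ k)
    where
    by-parity : (∃ λ m → k ≡ m + m ⊎ k ≡ m + m + 1ℤ) →
                ∃ λ q → + 8 * + (2 ^ suc j) ∣ (q + q + 1ℤ) * (q + q + 1ℤ) - T
    by-parity (m , inj₁ refl) = q , divides m (trans eq (trans (even m Pj) (cong (m *_) (sym 16Pj))))
      where
      even : ∀ m Pj → (m + m) * (+ 8 * Pj) ≡ m * (+ 16 * Pj)
      even = solve-∀
    by-parity (m , inj₂ refl) = q + + 2 * Pj , divides (m + q + 1ℤ + Pj) (begin
      (q + + 2 * Pj + (q + + 2 * Pj) + 1ℤ) * (q + + 2 * Pj + (q + + 2 * Pj) + 1ℤ) - T
        ≡⟨ expand q Pj T ⟩
      (q + q + 1ℤ) * (q + q + 1ℤ) - T + + 8 * Pj * (q + q + 1ℤ) + + 16 * Pj * Pj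
        ≡⟨ cong (λ X → X + + 8 * Pj * (q + q + 1ℤ) + + 16 * Pj * Pj) eq ⟩
      (m + m + 1ℤ) * (+ 8 * Pj) + + 8 * Pj * (q + q + 1ℤ) + + 16 * Pj * Pj
        ≡⟨ collect m q Pj ⟩
      (m + q + 1ℤ + Pj) * (+ 16 * Pj)
        ≡⟨ cong ((m + q + 1ℤ + Pj) *_) (sym 16Pj) ⟩
      (m + q + 1ℤ + Pj) * (+ 8 * + (2 ^ suc j)) ∎)
      where
      open ≡-Reasoning
      expand : ∀ q Pj T → (q + + 2 * Pj + (q + + 2 * Pj) + 1ℤ) * (q + + 2 * Pj + (q + + 2 * Pj) + 1ℤ) - T ≡
                          (q + q + 1ℤ) * (q + q + 1ℤ) - T + + 8 * Pj * (q + q + 1ℤ) + + 16 * Pj * Pj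
      expand = solve-∀
      collect : ∀ m q Pj → (m + m + 1ℤ) * (+ 8 * Pj) + + 8 * Pj * (q + q + 1ℤ) + + 16 * Pj * Pj ≡
                           (m + q + 1ℤ + Pj) * (+ 16 * Pj)
      collect = solve-∀

ThreeSquaresMod2^ : ℤ → ℕ → Set
ThreeSquaresMod2^ r K = ∃₂ λ a α → S 3 a × (α ≡ 1 ⊎ α ≡ 3) × + (2 ^ K) ∣ + a - + α * r

-- x is an odd square root of αr - y² - z² modulo 2^K
threeSquares-from-mod8 : ∀ r K α → α ≡ 1 ⊎ α ≡ 3 → ∀ y z →
                         + 8 ∣ + α * r - + y * + y - + z * + z - 1ℤ → ThreeSquaresMod2^ r K
threeSquares-from-mod8 r K α α∈ y z 8∣T-1 =
  let q , 8·2^K∣ = oddSqrt-mod-2^ (+ α * r - + y * + y - + z * + z) 8∣T-1 K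
      xs = V.map ∣_∣ (q + q + 1ℤ ∷ + y ∷ + z ∷ [])
  in sumSq xs , α , (positive q y z , xs , refl) , α∈ ,
     subst (+ (2 ^ K) ∣_) (sym (trans (cong (_- + α * r) (+sumSq-map-abs (q + q + 1ℤ ∷ + y ∷ + z ∷ [])))
                                      (regroup (q + q + 1ℤ) (+ y) (+ z) (+ α * r))))
           (∣-trans (∣n⇒∣m*n (+ 8) ∣-refl) 8·2^K∣)
  where
  regroup : ∀ x y z αr → x * x + (y * y + (z * z + 0ℤ)) - αr ≡ x * x - (αr - y * y - z * z)
  regroup = solve-∀
  positive : ∀ q y z → 1 ≤ sumSq (V.map ∣_∣ (q + q + 1ℤ ∷ + y ∷ + z ∷ []))
  positive q y z = ℕ.≤-trans (1≤sq (∤⇒1≤∣∣ (q + q + 1ℤ) (2∤odd q))) (ℕ.m≤m+n _ _)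

private
  threeSquares-by-residue : ∀ ρ k K → ρ < 8 → ¬ (+ 4 ∣ + ρ + k * + 8) → ThreeSquaresMod2^ (+ ρ + k * + 8) K
  threeSquares-by-residue 0 k K _ 4∤r = ⊥-elim (4∤r (divides (k * + 2) (multiple k)))
    where
    multiple : ∀ k → + 0 + k * + 8 ≡ k * + 2 * + 4
    multiple = solve-∀
  threeSquares-by-residue 4 k K _ 4∤r = ⊥-elim (4∤r (divides (1ℤ + k * + 2) (multiple k)))
    where
    multiple : ∀ k → + 4 + k * + 8 ≡ (1ℤ + k * + 2) * + 4
    multiple = solve-∀
  threeSquares-by-residue 1 k K _ _ =
    threeSquares-from-mod8 (+ 1 + k * + 8) K 1 (inj₁ refl) 0 0 (divides k (mod8 k))
    where
    mod8 : ∀ k → + 1 * (+ 1 + k * + 8) - + 0 * + 0 - + 0 * + 0 - 1ℤ ≡ k * + 8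
    mod8 = solve-∀
  threeSquares-by-residue 2 k K _ _ =
    threeSquares-from-mod8 (+ 2 + k * + 8) K 1 (inj₁ refl) 1 0 (divides k (mod8 k))
    where
    mod8 : ∀ k → + 1 * (+ 2 + k * + 8) - + 1 * + 1 - + 0 * + 0 - 1ℤ ≡ k * + 8
    mod8 = solve-∀
  threeSquares-by-residue 3 k K _ _ =
    threeSquares-from-mod8 (+ 3 + k * + 8) K 1 (inj₁ refl) 1 1 (divides k (mod8 k))
    where
    mod8 : ∀ k → + 1 * (+ 3 + k * + 8) - + 1 * + 1 - + 1 * + 1 - 1ℤ ≡ k * + 8
    mod8 = solve-∀
  threeSquares-by-residue 5 k K _ _ =
    threeSquares-from-mod8 (+ 5 + k * + 8) K 1 (inj₁ refl) 2 0 (divides k (mod8 k))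
    where
    mod8 : ∀ k → + 1 * (+ 5 + k * + 8) - + 2 * + 2 - + 0 * + 0 - 1ℤ ≡ k * + 8
    mod8 = solve-∀
  threeSquares-by-residue 6 k K _ _ =
    threeSquares-from-mod8 (+ 6 + k * + 8) K 1 (inj₁ refl) 1 2 (divides k (mod8 k))
    where
    mod8 : ∀ k → + 1 * (+ 6 + k * + 8) - + 1 * + 1 - + 2 * + 2 - 1ℤ ≡ k * + 8
    mod8 = solve-∀
  threeSquares-by-residue 7 k K _ _ =
    threeSquares-from-mod8 (+ 7 + k * + 8) K 3 (inj₂ refl) 2 0 (divides (+ 2 + + 3 * k) (mod8 k))
    where
    mod8 : ∀ k → + 3 * (+ 7 + k * + 8) - + 2 * + 2 - + 0 * + 0 - 1ℤ ≡ (+ 2 + + 3 * k) * + 8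
    mod8 = solve-∀
  threeSquares-by-residue (suc (suc (suc (suc (suc (suc (suc (suc _)))))))) _ _
                         (s≤s (s≤s (s≤s (s≤s (s≤s (s≤s (s≤s (s≤s ())))))))) _

threeSquares-mod-2^ : ∀ r → ¬ (+ 4 ∣ r) → ∀ K → ThreeSquaresMod2^ r K
threeSquares-mod-2^ r 4∤r K =
  subst (λ r → ThreeSquaresMod2^ r K) (sym r≡)
        (threeSquares-by-residue (r ℤ.%ℕ 8) (r ℤ./ℕ 8) K (ℤ.n%ℕd<d r 8) (4∤r ∘ subst (+ 4 ∣_) (sym r≡)))
  where
  r≡ : r ≡ + (r ℤ.%ℕ 8) + (r ℤ./ℕ 8) * + 8
  r≡ = ℤ.a≡a%ℕn+[a/ℕn]*n r 8

-- t = 4^e·r with 4 ∤ r: scale a three-square approximation of r by (2^e)²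
Sₙ-approximates[2] : 3 ≤ n → ApproximatesIntegers 2 (S n)
Sₙ-approximates[2] {n} 3≤n t K = by-cases (t ℤ.≟ 0ℤ)
  where
  1≤n : 1 ≤ n
  1≤n = ℕ.≤-trans (s≤s z≤n) 3≤n

  S-α : ∀ {α} → α ≡ 1 ⊎ α ≡ 3 → S n α
  S-α (inj₁ refl) = S-square 1≤n ℕ.≤-refl
  S-α (inj₂ refl) = S-≤ 3≤n (s≤s z≤n , 1 ∷ 1 ∷ 1 ∷ [] , refl)

  2∤α : ∀ {α} → α ≡ 1 ⊎ α ≡ 3 → ¬ 2 ∣ℕ α
  2∤α (inj₁ refl) = from-no (2 ℕ∣.∣? 1)
  2∤α (inj₂ refl) = from-no (2 ℕ∣.∣? 3)

  by-cases : Dec (t ≡ 0ℤ) → ∃₂ λ a a' → S n a × S n a' × ¬ 2 ∣ℕ a' × + (2 ^ K) ∣ + a - t * + a'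
  by-cases (yes refl) =
    2 ^ K ℕ.* 2 ^ K , 1 , S-square 1≤n (ℕ.m^n>0 2 K) , S-square 1≤n ℕ.≤-refl , 2∤α (inj₁ refl) ,
    divides (+ (2 ^ K)) (trans (ℤ.+-identityʳ _) (ℤ.pos-* (2 ^ K) (2 ^ K)))
  by-cases (no t≢0) =
    let e , r , t≡ , 4∤r = factorOutℤ (s≤s (s≤s z≤n)) t t≢0
        a₀ , α , Sa₀ , α∈ , divides κ a₀-αr≡ = threeSquares-mod-2^ r 4∤r K
        E = + (2 ^ e)
    in 2 ^ e ℕ.* 2 ^ e ℕ.* a₀ , α , S-scale (2 ^ e) (ℕ.m^n>0 2 e) (S-≤ 3≤n Sa₀) , S-α α∈ , 2∤α α∈ ,
       divides (E * E * κ) (begin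
         + (2 ^ e ℕ.* 2 ^ e ℕ.* a₀) - t * + α
           ≡⟨ cong₂ (λ a t → a - t * + α) (pos-*-* (2 ^ e) (2 ^ e) a₀) t≡ ⟩
         E * E * + a₀ - + (4 ^ e) * r * + α
           ≡⟨ cong (λ F → E * E * + a₀ - F * r * + α) (trans (cong +_ (4^e≡2^e*2^e e)) (ℤ.pos-* (2 ^ e) (2 ^ e))) ⟩
         E * E * + a₀ - E * E * r * + α                   ≡⟨ factor E (+ a₀) r (+ α) ⟩
         E * E * (+ a₀ - + α * r)                          ≡⟨ cong (E * E *_) a₀-αr≡ ⟩
         E * E * (κ * + (2 ^ K))                           ≡⟨ sym (ℤ.*-assoc (E * E) κ (+ (2 ^ K))) ⟩
         E * E * κ * + (2 ^ K)                             ∎)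
    where
    open ≡-Reasoning
    factor : ∀ E a₀ r α → E * E * a₀ - E * E * r * α ≡ E * E * (a₀ - α * r)
    factor = solve-∀

S₁-¬ratiosDense : Prime p → ¬ RatiosDenseInQp p (S 1)
S₁-¬ratiosDense p-prime = evenValuations⇒¬ratiosDense p-prime proj₁ (S₁-evenValuations p-prime)

S₂-ratiosDense⇒p%4≡1 : Prime p → RatiosDenseInQp p (S 2) → p % 4 ≡ 1
S₂-ratiosDense⇒p%4≡1 {p} p-prime dense = by-cases (prime≡2⊎odd p-prime)
  where
  by-cases : p ≡ 2 ⊎ (∃ λ h → p ≡ suc (h ℕ.+ h)) → p % 4 ≡ 1
  by-cases (inj₁ refl)        = ⊥-elim (S₂-¬ratiosDense[2] dense)
  by-cases (inj₂ (h , p≡2h+1)) = [ proj₂ , (λ (_ , ≡3) → ⊥-elim (¬dense ≡3)) ]′ p%4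
    where
    open OddPrime p-prime h p≡2h+1
    ¬dense : p % 4 ≡ 3 → ⊥
    ¬dense ≡3 = evenValuations⇒¬ratiosDense p-prime proj₁
      (S₂-evenValuations p-prime λ z P∣z²+1 →
        contradiction (trans (sym ≡3) (minusOneSquare⇒p%4≡1 (z , P∣z²+1))) λ ())
      dense

p%4≡1⇒S₂-ratiosDense : Prime p → p % 4 ≡ 1 → RatiosDenseInQp p (S 2)
p%4≡1⇒S₂-ratiosDense {p} p-prime ≡1 = by-cases (prime≡2⊎odd p-prime)
  where
  by-cases : p ≡ 2 ⊎ (∃ λ h → p ≡ suc (h ℕ.+ h)) → RatiosDenseInQp p (S 2)
  by-cases (inj₁ refl)        = contradiction ≡1 λ ()
  by-cases (inj₂ (h , p≡2h+1)) = OddPrime.S₂-ratiosDense p-prime h p≡2h+1 ≡1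

Sₙ-ratiosDense : 3 ≤ n → Prime p → RatiosDenseInQp p (S n)
Sₙ-ratiosDense {n} {p} 3≤n p-prime = by-cases (prime≡2⊎odd p-prime)
  where
  by-cases : p ≡ 2 ⊎ (∃ λ h → p ≡ suc (h ℕ.+ h)) → RatiosDenseInQp p (S n)
  by-cases (inj₁ refl)        = approximatesIntegers⇒ratiosDense prime[2] S-scale (Sₙ-approximates[2] 3≤n)
  by-cases (inj₂ (h , p≡2h+1)) = OddPrime.Sₙ-ratiosDense p-prime h p≡2h+1 3≤n

theorem4p1 : ((p : ℕ) → Prime p → ¬ RatiosDenseInQp p (S 1))
    × ((p : ℕ) → Prime p →
        (RatiosDenseInQp p (S 2) → p % 4 ≡ 1) × (p % 4 ≡ 1 → RatiosDenseInQp p (S 2)))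
    × ((n : ℕ) → 3 ≤ n → (p : ℕ) → Prime p → RatiosDenseInQp p (S n))
theorem4p1 =
  (λ p p-prime → S₁-¬ratiosDense p-prime) ,
  (λ p p-prime → S₂-ratiosDense⇒p%4≡1 p-prime , p%4≡1⇒S₂-ratiosDense p-prime) ,
  (λ n 3≤n p p-prime → Sₙ-ratiosDense 3≤n p-prime)
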